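{- There is an algorithm which, given a finite sum $f(x)=\sum_j d_j\zeta_j(x)$ with non-negative integer coefficients $d_j$, decides whether there exists a Wixarika poset $X$ with $f(x)=\zeta_X(x)$, and, in the positive case, returns all Wixarika posets $X$ (up to isomorphism) with $\zeta_X=f$.
   Context: All posets are finite. For $n\ge1$, $\mathbf{n}$ denotes the chain $\{1<2<\cdots<n\}$ and $\zeta_n(x)=\frac{x^n}{(1-x)^{n+1}}$. For a poset $X$, $\Omega^\circ_X(n)$ is the number of strict order preserving maps $X\to\mathbf{n}$ (maps $g$ with $a<b\Rightarrow g(a)<g(b)$), and $\zeta_X(x)=\sum_{n\ge1}\Omega^\circ_X(n)x^n$ is its strict order series. The concatenation $X*Y$ is the disjoint union of $X$ and $Y$ with their orders, plus $a<b$ for all $a\in X$, $b\in Y$. For a poset $X$, $D(X)=\mathbf{1}*(\mathbf{1}\sqcup X)*\mathbf{1}$, where $\sqcup$ is disjoint union with no relations between the parts. A Wixarika poset is a finite poset obtained from the one-point poset $\mathbf{1}$ by iterated application of $D$ and $*$. -}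

module Defs where

open import Data.Bool using (Bool; true; false; if_then_else_; _∧_; _∨_; not)
open import Data.Nat using (ℕ; zero; suc; _+_; _*_; _∸_; _<ᵇ_; _≡ᵇ_)
open import Data.Fin using (Fin; toℕ; splitAt)
open import Data.Sum using (_⊎_; inj₁; inj₂)
open import Data.Product using (Σ; _×_; _,_; ∃)
open import Data.List using (List; []; _∷_; map; upTo; allFin; concatMap)
open import Data.Bool.ListAction using (and)
open import Data.Nat.ListAction using (sum)
open import Data.Vec using (Vec; lookup) renaming ([] to []ᵥ; _∷_ to _∷ᵥ_)
open import Function.Bundles using (_↔_; Inverse)
open import Relation.Binary.PropositionalEquality using (_≡_; refl)

record FinPoset : Set where
  field
    size    : ℕ
    lt      : Fin size → Fin size → Bool
    irrefl  : ∀ a → lt a a ≡ false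
    trans   : ∀ a b c → lt a b ≡ true → lt b c ≡ true → lt a c ≡ true
open FinPoset public

_≅_ : FinPoset → FinPoset → Set
X ≅ Y = Σ (Fin (size X) ↔ Fin (size Y)) λ e →
          ∀ a b → lt X a b ≡ lt Y (Inverse.to e a) (Inverse.to e b)

sumLt : ∀ {m n} → Bool → (Fin m → Fin m → Bool) → (Fin n → Fin n → Bool)
      → Fin m ⊎ Fin n → Fin m ⊎ Fin n → Bool
sumLt c X Y (inj₁ i) (inj₁ j) = X i j
sumLt c X Y (inj₂ i) (inj₂ j) = Y i j
sumLt c X Y (inj₁ i) (inj₂ j) = c
sumLt c X Y (inj₂ i) (inj₁ j) = false

sumIrrefl : ∀ {m n} c (X : Fin m → Fin m → Bool) (Y : Fin n → Fin n → Bool)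
          → (∀ a → X a a ≡ false) → (∀ a → Y a a ≡ false)
          → ∀ x → sumLt c X Y x x ≡ false
sumIrrefl c X Y ix iy (inj₁ i) = ix i
sumIrrefl c X Y ix iy (inj₂ i) = iy i

sumTrans : ∀ {m n} c (X : Fin m → Fin m → Bool) (Y : Fin n → Fin n → Bool)
         → (∀ a b d → X a b ≡ true → X b d ≡ true → X a d ≡ true)
         → (∀ a b d → Y a b ≡ true → Y b d ≡ true → Y a d ≡ true)
         → ∀ x y z → sumLt c X Y x y ≡ true → sumLt c X Y y z ≡ true
         → sumLt c X Y x z ≡ true
sumTrans c X Y tx ty (inj₁ i) (inj₁ j) (inj₁ k) p q = tx i j k p q
sumTrans c X Y tx ty (inj₁ i) (inj₁ j) (inj₂ k) p q = q
sumTrans c X Y tx ty (inj₁ i) (inj₂ j) (inj₂ k) p q = p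
sumTrans c X Y tx ty (inj₂ i) (inj₂ j) (inj₂ k) p q = ty i j k p q
sumTrans c X Y tx ty (inj₁ i) (inj₂ j) (inj₁ k) p ()
sumTrans c X Y tx ty (inj₂ i) (inj₁ j) z () q
sumTrans c X Y tx ty (inj₂ i) (inj₂ j) (inj₁ k) p ()

glue : Bool → FinPoset → FinPoset → FinPoset
glue c X Y = record
  { size   = size X + size Y
  ; lt     = λ a b → sumLt c (lt X) (lt Y) (splitAt (size X) a) (splitAt (size X) b)
  ; irrefl = λ a → sumIrrefl c (lt X) (lt Y) (irrefl X) (irrefl Y) (splitAt (size X) a)
  ; trans  = λ a b d → sumTrans c (lt X) (lt Y) (trans X) (trans Y)
               (splitAt (size X) a) (splitAt (size X) b) (splitAt (size X) d)
  }

_⊔_ : FinPoset → FinPoset → FinPoset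
_⊔_ = glue false

_✶_ : FinPoset → FinPoset → FinPoset
_✶_ = glue true

𝟏 : FinPoset
𝟏 = record { size = 1 ; lt = λ _ _ → false ; irrefl = λ _ → refl ; trans = λ _ _ _ () }

D : FinPoset → FinPoset
D X = 𝟏 ✶ ((𝟏 ⊔ X) ✶ 𝟏)

-- Wixarika posets: generated from 𝟏 by D and *, considered up to isomorphism
data WTerm : Set where
  one  : WTerm
  d    : WTerm → WTerm
  _·_  : WTerm → WTerm → WTerm

⟦_⟧ : WTerm → FinPoset
⟦ one ⟧   = 𝟏
⟦ d t ⟧   = D ⟦ t ⟧
⟦ s · t ⟧ = ⟦ s ⟧ ✶ ⟦ t ⟧

IsWixarika : FinPoset → Set
IsWixarika X = ∃ λ t → X ≅ ⟦ t ⟧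

-- all vectors of length k with entries in Fin n (i.e. all maps Fin k → Fin n)
allVecs : (k n : ℕ) → List (Vec (Fin n) k)
allVecs zero    n = []ᵥ ∷ []
allVecs (suc k) n = concatMap (λ v → map (_∷ᵥ v) (allFin n)) (allVecs k n)

isStrict : (X : FinPoset) {n : ℕ} → Vec (Fin n) (size X) → Bool
isStrict X g = and (map (λ a → and (map (λ b →
    not (lt X a b) ∨ (toℕ (lookup g a) <ᵇ toℕ (lookup g b)))
  (allFin (size X)))) (allFin (size X)))

Ω° : FinPoset → ℕ → ℕ
Ω° X n = sum (map (λ g → if isStrict X g then 1 else 0) (allVecs (size X) n))

-- Formal power series with ℕ coefficients (coefficient of x^m)

Series : Set
Series = ℕ → ℕ

_·ₛ_ : Series → Series → Series
(f ·ₛ g) m = sum (map (λ k → f k * g (m ∸ k)) (upTo (suc m)))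

oneₛ : Series
oneₛ zero    = 1
oneₛ (suc _) = 0

_^ₛ_ : Series → ℕ → Series
f ^ₛ zero  = oneₛ
f ^ₛ suc k = f ·ₛ (f ^ₛ k)

monoₛ : ℕ → Series
monoₛ n m = if m ≡ᵇ n then 1 else 0

geomₛ : Series
geomₛ _ = 1

ζ : ℕ → Series
ζ n = monoₛ n ·ₛ (geomₛ ^ₛ suc n)

ζP : FinPoset → Series
ζP X zero    = 0
ζP X (suc n) = Ω° X (suc n)

-- f = Σ_{j≥1} d_j ζ_j, where the list (d_1, d_2, ..., d_k) gives the coefficients
fromCoeffs : ℕ → List ℕ → Series
fromCoeffs j []       m = 0
fromCoeffs j (c ∷ cs) m = c * ζ j m + fromCoeffs (suc j) cs m

seriesOf : List ℕ → Series
seriesOf = fromCoeffs 1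

-- For a Wixarika poset X, n ↦ Ω°_X(n) is a polynomial of degree exactly |X| with positive leading
-- coefficient: Ω°_𝟏(n) = n, Ω°_{𝟏 ⊔ X}(n) = n · Ω°_X(n), and Ω°_{X * Y} is the convolution of the
-- first difference of Ω°_X with Ω°_Y, because a strict map on X * Y splits according to the maximal
-- value k taken on X. On the other side ζ_j has coefficients (m choose j), so f = Σ d_j ζ_j is a
-- polynomial of degree at most 1 + length d. Hence ζ_X = f forces |X| ≤ 1 + length d, leaving finitely
-- many candidate terms; for each of them ζ_X = f is decided by comparing two polynomials of bounded
-- degree at finitely many points, and the survivors are listed up to isomorphism, which is decidable
-- by exhaustive search.

module Submission where

open import Defs hiding (trans)
open import Data.Nat using (ℕ)
open import Data.List using (List)
open import Data.List.Relation.Unary.All using (All)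
open import Data.List.Relation.Unary.Any using (Any)
open import Data.List.Relation.Unary.AllPairs using (AllPairs)
open import Data.Product using (Σ; _×_; ∃; _,_)
open import Relation.Nullary using (Dec; ¬_)
open import Relation.Binary.PropositionalEquality using (_≗_)

module FiniteDifferences where

  open import Data.Fin using (Fin; toℕ; fromℕ<)
  open import Data.Fin.Properties using (all?; toℕ-fromℕ<)
  open import Data.Integer using (ℤ; +_; 0ℤ; _+_; _-_; _*_; _≟_)
  open import Data.Integer.Properties using (+-identityˡ; +-inverseʳ; *-comm; pos-+)
  open import Data.Integer.Tactic.RingSolver using (solve-∀)
  open import Data.Nat as ℕ using (zero; suc; _≤_; _<_; _≤′_; ≤′-refl; ≤′-step; z≤n; s≤s)
  import Data.Nat.Properties as ℕₚ
  open import Data.Sum using (inj₁; inj₂)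
  open import Function using (_∘_)
  open import Relation.Nullary using (Dec; yes; no; contradiction)
  open import Relation.Binary.PropositionalEquality

  Δ : (ℕ → ℤ) → ℕ → ℤ
  Δ f n = f (suc n) - f n

  -- The k-th forward difference of f is constantly c; equivalently f is a
  -- polynomial of degree at most k with leading coefficient c / k!.
  ConstDiff : ℕ → ℤ → (ℕ → ℤ) → Set
  ConstDiff zero    c f = ∀ n → f n ≡ c
  ConstDiff (suc k) c f = ConstDiff k c (Δ f)

  record DegreeAtMost (k : ℕ) (f : ℕ → ℤ) : Set where
    constructor degree≤
    field
      {leading} : ℤ
      constDiff : ConstDiff k leading f

  Δ-cong : ∀ {f g} → f ≗ g → Δ f ≗ Δ g
  Δ-cong f≗g n = cong₂ _-_ (f≗g (suc n)) (f≗g n)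

  ConstDiff-cong : ∀ k {c f g} → f ≗ g → ConstDiff k c f → ConstDiff k c g
  ConstDiff-cong zero    f≗g p n = trans (sym (f≗g n)) (p n)
  ConstDiff-cong (suc k) f≗g p   = ConstDiff-cong k (Δ-cong f≗g) p

  ConstDiff-+ : ∀ k {c e f g} → ConstDiff k c f → ConstDiff k e g →
                ConstDiff k (c + e) (λ n → f n + g n)
  ConstDiff-+ zero    p q n = cong₂ _+_ (p n) (q n)
  ConstDiff-+ (suc k) {f = f} {g} p q = ConstDiff-cong k Δ-+ (ConstDiff-+ k p q)
    where
    interchange : ∀ a b c e → (a - b) + (c - e) ≡ (a + c) - (b + e)
    interchange = solve-∀
    Δ-+ : (λ n → Δ f n + Δ g n) ≗ Δ (λ n → f n + g n)
    Δ-+ n = interchange (f (suc n)) (f n) (g (suc n)) (g n)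

  ConstDiff-*ˡ : ∀ k s {c f} → ConstDiff k c f → ConstDiff k (s * c) (λ n → s * f n)
  ConstDiff-*ˡ zero    s p n = cong (s *_) (p n)
  ConstDiff-*ˡ (suc k) s {f = f} p = ConstDiff-cong k Δ-* (ConstDiff-*ˡ k s p)
    where
    distrib : ∀ s a b → s * (a - b) ≡ s * a - s * b
    distrib = solve-∀
    Δ-* : (λ n → s * Δ f n) ≗ Δ (λ n → s * f n)
    Δ-* n = distrib s (f (suc n)) (f n)

  ConstDiff-∘suc : ∀ k {c f} → ConstDiff k c f → ConstDiff k c (f ∘ suc)
  ConstDiff-∘suc zero    p n = p (suc n)
  ConstDiff-∘suc (suc k) p   = ConstDiff-∘suc k p

  ConstDiff-suc : ∀ k {c f} → ConstDiff k c f → ConstDiff (suc k) 0ℤ f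
  ConstDiff-suc zero    {c} p n = trans (cong₂ _-_ (p (suc n)) (p n)) (+-inverseʳ c)
  ConstDiff-suc (suc k) p       = ConstDiff-suc k p

  ConstDiff-< : ∀ {k e c f} → k < e → ConstDiff k c f → ConstDiff e 0ℤ f
  ConstDiff-< {k} {c = c} {f} k<e = go (ℕₚ.≤⇒≤′ k<e)
    where
    go : ∀ {e} → suc k ≤′ e → ConstDiff k c f → ConstDiff e 0ℤ f
    go ≤′-refl               p = ConstDiff-suc k p
    go (≤′-step {e} k<e) p = ConstDiff-suc e (go k<e p)

  Δ-*id : ∀ f → (λ n → + n * Δ f n + f (suc n)) ≗ Δ (λ n → + n * f n)
  Δ-*id f n = trans (product-rule (+ n) (f (suc n)) (f n))
                    (cong (λ m → m * f (suc n) - + n * f n) (sym (pos-+ 1 n)))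
    where
    product-rule : ∀ n a b → n * (a - b) + a ≡ (+ 1 + n) * a - n * b
    product-rule = solve-∀

  ConstDiff-*id : ∀ k {c f} → ConstDiff k c f → ConstDiff (suc k) (+ suc k * c) (λ n → + n * f n)
  ConstDiff-*id zero {c} {f} p = ConstDiff-cong 0 (Δ-*id f) λ n →
    trans (cong₂ (λ δ a → + n * δ + a) (ConstDiff-suc 0 p n) (p (suc n))) (simplify (+ n) c)
    where
    simplify : ∀ n c → n * 0ℤ + c ≡ + 1 * c
    simplify = solve-∀
  ConstDiff-*id (suc k) {c} {f} p = ConstDiff-cong (suc k) (Δ-*id f)
    (subst (λ c′ → ConstDiff (suc k) c′ (λ n → + n * Δ f n + f (suc n))) coefficient
      (ConstDiff-+ (suc k) {f = λ n → + n * Δ f n} {g = f ∘ suc}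
        (ConstDiff-*id k {f = Δ f} p) (ConstDiff-∘suc (suc k) {f = f} p)))
    where
    distribʳ : ∀ m c → m * c + c ≡ (+ 1 + m) * c
    distribʳ = solve-∀
    coefficient : + suc k * c + c ≡ + suc (suc k) * c
    coefficient = trans (distribʳ (+ suc k) c) (cong (_* c) (sym (pos-+ 1 (suc k))))

  DegreeAtMost-mono : ∀ {k e f} → k ≤ e → DegreeAtMost k f → DegreeAtMost e f
  DegreeAtMost-mono k≤e (degree≤ p) with ℕₚ.m≤n⇒m<n∨m≡n k≤e
  ... | inj₁ k<e  = degree≤ (ConstDiff-< k<e p)
  ... | inj₂ refl = degree≤ p

  DegreeAtMost-cong : ∀ {k f g} → f ≗ g → DegreeAtMost k f → DegreeAtMost k g
  DegreeAtMost-cong {k} f≗g (degree≤ p) = degree≤ (ConstDiff-cong k f≗g p)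

  DegreeAtMost-+ : ∀ {k f g} → DegreeAtMost k f → DegreeAtMost k g → DegreeAtMost k (λ n → f n + g n)
  DegreeAtMost-+ {k} {f} {g} (degree≤ p) (degree≤ q) = degree≤ (ConstDiff-+ k {f = f} {g} p q)

  Δ-injective : ∀ {f g} → Δ f ≗ Δ g → f 0 ≡ g 0 → f ≗ g
  Δ-injective Δf≗Δg f0≡g0 zero = f0≡g0
  Δ-injective {f} {g} Δf≗Δg f0≡g0 (suc n) = begin
    f (suc n)                ≡⟨ telescope (f (suc n)) (f n) ⟩
    (f (suc n) - f n) + f n  ≡⟨ cong₂ _+_ (Δf≗Δg n) (Δ-injective {f} {g} Δf≗Δg f0≡g0 n) ⟩
    (g (suc n) - g n) + g n  ≡⟨ telescope (g (suc n)) (g n) ⟨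
    g (suc n)                ∎
    where
    open ≡-Reasoning
    telescope : ∀ a b → a ≡ (a - b) + b
    telescope = solve-∀

  ConstDiff-ext : ∀ k {c c′ f g} → ConstDiff k c f → ConstDiff k c′ g →
                  (∀ n → n ≤ k → f n ≡ g n) → f ≗ g
  ConstDiff-ext zero    p q agree n = trans (p n) (trans (sym (p 0)) (trans (agree 0 z≤n) (trans (q 0) (sym (q n)))))
  ConstDiff-ext (suc k) {f = f} {g} p q agree =
    Δ-injective (ConstDiff-ext k p q Δagree) (agree 0 z≤n)
    where
    Δagree : ∀ n → n ≤ k → Δ f n ≡ Δ g n
    Δagree n n≤k = cong₂ _-_ (agree (suc n) (s≤s n≤k)) (agree n (ℕₚ.m≤n⇒m≤1+n n≤k))

  ConstDiff-unique : ∀ k {c c′ f g} → ConstDiff k c f → ConstDiff k c′ g → f ≗ g → c ≡ c′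
  ConstDiff-unique zero    p q f≗g = trans (sym (p 0)) (trans (f≗g 0) (q 0))
  ConstDiff-unique (suc k) p q f≗g = ConstDiff-unique k p q (Δ-cong f≗g)

  ≗-dec : ∀ k {f g} → DegreeAtMost k f → DegreeAtMost k g → Dec (f ≗ g)
  ≗-dec k {f} {g} (degree≤ p) (degree≤ q) with all? (λ (i : Fin (suc k)) → f (toℕ i) ≟ g (toℕ i))
  ... | yes agree    = yes (ConstDiff-ext k p q λ n n≤k →
                             subst (λ m → f m ≡ g m) (toℕ-fromℕ< (s≤s n≤k)) (agree (fromℕ< (s≤s n≤k))))
  ... | no ¬agree    = no λ f≗g → ¬agree (f≗g ∘ toℕ)

  degree-lower-bound : ∀ {k e c f} → ConstDiff k c f → c ≢ 0ℤ → DegreeAtMost e f → k ≤ e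
  degree-lower-bound {k} {e} p c≢0 (degree≤ q) with k ℕ.≤? e
  ... | yes k≤e = k≤e
  ... | no  k≰e = contradiction (ConstDiff-unique k p (ConstDiff-< (ℕₚ.≰⇒> k≰e) q) (λ _ → refl)) c≢0

  -- conv E G n = Σ_{k<n} E k · G (n-1-k), the coefficient of x^(n-1) in the
  -- product of the generating series of E and G.
  conv : (ℕ → ℤ) → (ℕ → ℤ) → ℕ → ℤ
  conv E G zero    = 0ℤ
  conv E G (suc n) = E n * G 0 + conv E (G ∘ suc) n

  conv-congˡ : ∀ {E E′} G → E ≗ E′ → conv E G ≗ conv E′ G
  conv-congˡ G E≗E′ zero    = refl
  conv-congˡ G E≗E′ (suc n) = cong₂ (λ e c → e * G 0 + c) (E≗E′ n) (conv-congˡ (G ∘ suc) E≗E′ n)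

  conv-sub : ∀ E G H n → conv E G n - conv E H n ≡ conv E (λ m → G m - H m) n
  conv-sub E G H zero    = refl
  conv-sub E G H (suc n) =
    trans (distrib (E n) (G 0) (H 0) (conv E (G ∘ suc) n) (conv E (H ∘ suc) n))
          (cong (_+_ (E n * (G 0 - H 0))) (conv-sub E (G ∘ suc) (H ∘ suc) n))
    where
    distrib : ∀ e g h x y → (e * g + x) - (e * h + y) ≡ e * (g - h) + (x - y)
    distrib = solve-∀

  conv-zeroʳ : ∀ E {G} → (∀ m → G m ≡ 0ℤ) → ∀ n → conv E G n ≡ 0ℤ
  conv-zeroʳ E G≗0 zero    = refl
  conv-zeroʳ E G≗0 (suc n) =
    trans (cong₂ (λ g c → E n * g + c) (G≗0 0) (conv-zeroʳ E (G≗0 ∘ suc) n)) (simplify (E n))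
    where
    simplify : ∀ a → a * 0ℤ + 0ℤ ≡ 0ℤ
    simplify = solve-∀

  Δ-conv : ∀ E G n → Δ (conv E G) n ≡ E n * G 0 + conv E (Δ G) n
  Δ-conv E G n = trans (assoc (E n * G 0) (conv E (G ∘ suc) n) (conv E G n))
                       (cong (_+_ (E n * G 0)) (conv-sub E (G ∘ suc) G n))
    where
    assoc : ∀ a x y → (a + x) - y ≡ a + (x - y)
    assoc = solve-∀

  ConstDiff-conv : ∀ b {a c e E G} → ConstDiff a c E → ConstDiff b e G →
                   ConstDiff (suc (b ℕ.+ a)) (c * e) (conv E G)
  ConstDiff-conv zero {a} {c} {e} {E} {G} p q =
    subst (λ c′ → ConstDiff a c′ (Δ (conv E G))) (*-comm e c)
      (ConstDiff-cong a Δconv≗ (ConstDiff-*ˡ a e p))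
    where
    Δconv≗ : (λ n → e * E n) ≗ Δ (conv E G)
    Δconv≗ n = sym (begin
      Δ (conv E G) n               ≡⟨ Δ-conv E G n ⟩
      E n * G 0 + conv E (Δ G) n   ≡⟨ cong₂ (λ g c → E n * g + c) (q 0) (conv-zeroʳ E (ConstDiff-suc 0 q) n) ⟩
      E n * e + 0ℤ                 ≡⟨ simplify (E n) e ⟩
      e * E n                      ∎)
      where
      open ≡-Reasoning
      simplify : ∀ a e → a * e + 0ℤ ≡ e * a
      simplify = solve-∀
  ConstDiff-conv (suc b) {a} {c} {e} {E} {G} p q =
    subst (λ c′ → ConstDiff (suc (b ℕ.+ a)) c′ (Δ (conv E G))) (+-identityˡ (c * e))
      (ConstDiff-cong (suc (b ℕ.+ a)) Δconv≗
        (ConstDiff-+ (suc (b ℕ.+ a)) {f = λ n → G 0 * E n} {g = conv E (Δ G)}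
          (ConstDiff-< (s≤s (ℕₚ.m≤n+m a b)) (ConstDiff-*ˡ a (G 0) p))
          (ConstDiff-conv b p q)))
    where
    Δconv≗ : (λ n → G 0 * E n + conv E (Δ G) n) ≗ Δ (conv E G)
    Δconv≗ n = sym (trans (Δ-conv E G n) (cong (_+ conv E (Δ G) n) (*-comm (E n) (G 0))))

module Sums where

  open import Data.Bool using (Bool; true; false; _∧_; if_then_else_)
  open import Data.Fin using (Fin) renaming (zero to fzero; suc to fsuc)
  open import Data.Fin.Properties using () renaming (_≟_ to _≟ᶠ_)
  open import Data.List using (List; []; _∷_; map; concatMap; _++_; allFin)
  open import Data.List.Properties using (map-tabulate)
  open import Data.Nat using (zero; suc; _+_; _*_; _<_; _≟_; s≤s⁻¹)
  open import Data.Nat.ListAction using (sum)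
  open import Data.Nat.Properties
  open import Data.Sum using (inj₁; inj₂)
  open import Data.Vec as Vec using (Vec) renaming ([] to []ᵥ; _∷_ to _∷ᵥ_; _++_ to _++ᵥ_)
  open import Data.Vec.Properties using (≡-dec)
  open import Function using (_∘_)
  open import Function.Bundles using (_⇔_; mk⇔)
  open import Relation.Nullary using (Dec; does)
  open import Relation.Nullary.Decidable using (does-⇔; dec-true; dec-false)
  open import Relation.Binary.PropositionalEquality hiding ([_])
  open import Algebra.Properties.CommutativeSemigroup +-commutativeSemigroup
    using () renaming (interchange to +-interchange)

  [_] : Bool → ℕ
  [ b ] = if b then 1 else 0

  [∧] : ∀ a b → [ a ∧ b ] ≡ [ a ] * [ b ]
  [∧] false b = refl
  [∧] true  b = sym (+-identityʳ [ b ])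

  [∧]-*-comm : ∀ a b c → [ a ∧ b ] * c ≡ [ b ] * ([ a ] * c)
  [∧]-*-comm a b c = trans (cong (_* c) (trans ([∧] a b) (*-comm [ a ] [ b ]))) (*-assoc [ b ] [ a ] c)

  ΣList : {A : Set} → List A → (A → ℕ) → ℕ
  ΣList xs w = sum (map w xs)

  private variable A B : Set

  ΣList-cong : ∀ (xs : List A) {v w} → v ≗ w → ΣList xs v ≡ ΣList xs w
  ΣList-cong []       v≗w = refl
  ΣList-cong (x ∷ xs) v≗w = cong₂ _+_ (v≗w x) (ΣList-cong xs v≗w)

  ΣList-+ : ∀ (xs : List A) v w → ΣList xs (λ x → v x + w x) ≡ ΣList xs v + ΣList xs w
  ΣList-+ []       v w = refl
  ΣList-+ (x ∷ xs) v w = begin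
    (v x + w x) + ΣList xs (λ x → v x + w x)   ≡⟨ cong (v x + w x +_) (ΣList-+ xs v w) ⟩
    (v x + w x) + (ΣList xs v + ΣList xs w)    ≡⟨ +-interchange (v x) (w x) (ΣList xs v) (ΣList xs w) ⟩
    (v x + ΣList xs v) + (w x + ΣList xs w)    ∎
    where open ≡-Reasoning

  ΣList-*ˡ : ∀ (xs : List A) c w → ΣList xs (λ x → c * w x) ≡ c * ΣList xs w
  ΣList-*ˡ []       c w = sym (*-zeroʳ c)
  ΣList-*ˡ (x ∷ xs) c w =
    trans (cong (c * w x +_) (ΣList-*ˡ xs c w)) (sym (*-distribˡ-+ c (w x) (ΣList xs w)))

  ΣList-zero : ∀ (xs : List A) → ΣList xs (λ _ → 0) ≡ 0
  ΣList-zero []       = refl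
  ΣList-zero (x ∷ xs) = ΣList-zero xs

  ΣList-++ : ∀ (xs ys : List A) w → ΣList (xs ++ ys) w ≡ ΣList xs w + ΣList ys w
  ΣList-++ []       ys w = refl
  ΣList-++ (x ∷ xs) ys w =
    trans (cong (w x +_) (ΣList-++ xs ys w)) (sym (+-assoc (w x) (ΣList xs w) (ΣList ys w)))

  ΣList-map : ∀ (f : A → B) xs w → ΣList (map f xs) w ≡ ΣList xs (w ∘ f)
  ΣList-map f []       w = refl
  ΣList-map f (x ∷ xs) w = cong (w (f x) +_) (ΣList-map f xs w)

  ΣList-concatMap : ∀ (f : A → List B) xs w →
                    ΣList (concatMap f xs) w ≡ ΣList xs (λ x → ΣList (f x) w)
  ΣList-concatMap f []       w = refl
  ΣList-concatMap f (x ∷ xs) w =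
    trans (ΣList-++ (f x) (concatMap f xs) w) (cong (ΣList (f x) w +_) (ΣList-concatMap f xs w))

  ΣList-swap : ∀ (xs : List A) (ys : List B) (w : A → B → ℕ) →
               ΣList xs (λ x → ΣList ys (w x)) ≡ ΣList ys (λ y → ΣList xs (λ x → w x y))
  ΣList-swap []       ys w = sym (ΣList-zero ys)
  ΣList-swap (x ∷ xs) ys w =
    trans (cong (ΣList ys (w x) +_) (ΣList-swap xs ys w))
          (sym (ΣList-+ ys (w x) (λ y → ΣList xs (λ x → w x y))))

  ΣFin : ∀ n → (Fin n → ℕ) → ℕ
  ΣFin n = ΣList (allFin n)

  ΣFin-suc : ∀ n h → ΣFin (suc n) h ≡ h fzero + ΣFin n (h ∘ fsuc)
  ΣFin-suc n h = cong (λ t → h fzero + sum t)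
    (trans (map-tabulate (fsuc {n}) h) (sym (map-tabulate (λ i → i) (h ∘ fsuc))))

  ΣFin-cong : ∀ n {g h : Fin n → ℕ} → g ≗ h → ΣFin n g ≡ ΣFin n h
  ΣFin-cong n = ΣList-cong (allFin n)

  ΣFin-const : ∀ n c → ΣFin n (λ _ → c) ≡ n * c
  ΣFin-const zero    c = refl
  ΣFin-const (suc n) c = trans (ΣFin-suc n (λ _ → c)) (cong (c +_) (ΣFin-const n c))

  ΣFin-pick : ∀ n (y : Fin n) (h : Fin n → ℕ) → ΣFin n (λ x → [ does (x ≟ᶠ y) ] * h x) ≡ h y
  ΣFin-pick (suc n) fzero h =
    trans (ΣFin-suc n (λ x → [ does (x ≟ᶠ fzero) ] * h x)) (trans (cong (1 * h fzero +_) (ΣList-zero (allFin n)))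
                                (trans (+-identityʳ _) (+-identityʳ (h fzero))))
  ΣFin-pick (suc n) (fsuc y) h = trans (ΣFin-suc n (λ x → [ does (x ≟ᶠ fsuc y) ] * h x)) (ΣFin-pick n y (h ∘ fsuc))

  ΣVec : ∀ k n → (Vec (Fin n) k → ℕ) → ℕ
  ΣVec k n = ΣList (allVecs k n)

  ΣVec-suc : ∀ k n (w : Vec (Fin n) (suc k) → ℕ) →
             ΣVec (suc k) n w ≡ ΣVec k n (λ v → ΣFin n (λ x → w (x ∷ᵥ v)))
  ΣVec-suc k n w = trans (ΣList-concatMap _ (allVecs k n) w)
    (ΣList-cong (allVecs k n) (λ v → ΣList-map (_∷ᵥ v) (allFin n) w))

  ΣVec-++ : ∀ a b n (w : Vec (Fin n) (a + b) → ℕ) →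
            ΣVec (a + b) n w ≡ ΣVec a n (λ u → ΣVec b n (λ v → w (u ++ᵥ v)))
  ΣVec-++ zero    b n w = sym (+-identityʳ _)
  ΣVec-++ (suc a) b n w = begin
    ΣVec (suc (a + b)) n w
      ≡⟨ ΣVec-suc (a + b) n w ⟩
    ΣVec (a + b) n (λ g → ΣFin n (λ x → w (x ∷ᵥ g)))
      ≡⟨ ΣVec-++ a b n _ ⟩
    ΣVec a n (λ u → ΣVec b n (λ v → ΣFin n (λ x → w (x ∷ᵥ u ++ᵥ v))))
      ≡⟨ ΣList-cong (allVecs a n) (λ u → ΣList-swap (allVecs b n) (allFin n) _) ⟩
    ΣVec a n (λ u → ΣFin n (λ x → ΣVec b n (λ v → w (x ∷ᵥ u ++ᵥ v))))
      ≡⟨ ΣVec-suc a n _ ⟨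
    ΣVec (suc a) n (λ u → ΣVec b n (λ v → w (u ++ᵥ v)))
      ∎
    where open ≡-Reasoning

  _≟ᵛ_ : ∀ {k n} → (u v : Vec (Fin n) k) → Dec (u ≡ v)
  _≟ᵛ_ = ≡-dec _≟ᶠ_

  ΣVec-pick : ∀ k n (t : Vec (Fin n) k) (w : Vec (Fin n) k → ℕ) →
              ΣVec k n (λ u → [ does (u ≟ᵛ t) ] * w u) ≡ w t
  ΣVec-pick zero    n []ᵥ      w = trans (+-identityʳ _) (+-identityʳ (w []ᵥ))
  ΣVec-pick (suc k) n (y ∷ᵥ t) w = begin
    ΣVec (suc k) n (λ u → [ does (u ≟ᵛ (y ∷ᵥ t)) ] * w u)
      ≡⟨ ΣVec-suc k n _ ⟩
    ΣVec k n (λ v → ΣFin n (λ x → [ does (x ≟ᶠ y) ∧ does (v ≟ᵛ t) ] * w (x ∷ᵥ v)))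
      ≡⟨ ΣList-cong (allVecs k n) (λ v →
           trans (ΣFin-cong n (λ x → [∧]-*-comm (does (x ≟ᶠ y)) (does (v ≟ᵛ t)) _))
                                               (ΣList-*ˡ (allFin n) [ does (v ≟ᵛ t) ] _)) ⟩
    ΣVec k n (λ v → [ does (v ≟ᵛ t) ] * ΣFin n (λ x → [ does (x ≟ᶠ y) ] * w (x ∷ᵥ v)))
      ≡⟨ ΣList-cong (allVecs k n) (λ v → cong ([ does (v ≟ᵛ t) ] *_) (ΣFin-pick n y _)) ⟩
    ΣVec k n (λ v → [ does (v ≟ᵛ t) ] * w (y ∷ᵥ v))
      ≡⟨ ΣVec-pick k n t (w ∘ (y ∷ᵥ_)) ⟩
    w (y ∷ᵥ t)
      ∎
    where open ≡-Reasoning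

  ΣVec-reindex : ∀ {k k′ n} (φ : Vec (Fin n) k′ → Vec (Fin n) k) (ψ : Vec (Fin n) k → Vec (Fin n) k′) →
                 (∀ u → φ (ψ u) ≡ u) → (∀ v → ψ (φ v) ≡ v) →
                 ∀ w → ΣVec k′ n (w ∘ φ) ≡ ΣVec k n w
  ΣVec-reindex {k} {k′} {n} φ ψ φψ ψφ w = begin
    ΣVec k′ n (w ∘ φ)
      ≡⟨ ΣList-cong (allVecs k′ n) (λ v → ΣVec-pick k n (φ v) w) ⟨
    ΣVec k′ n (λ v → ΣVec k n (λ u → [ does (u ≟ᵛ φ v) ] * w u))
      ≡⟨ ΣList-swap (allVecs k′ n) (allVecs k n) _ ⟩
    ΣVec k n (λ u → ΣVec k′ n (λ v → [ does (u ≟ᵛ φ v) ] * w u))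
      ≡⟨ ΣList-cong (allVecs k n) (λ u → ΣList-cong (allVecs k′ n) (λ v →
           cong (λ b → [ b ] * w u) (does-⇔ (inverse u v) (u ≟ᵛ φ v) (v ≟ᵛ ψ u)))) ⟩
    ΣVec k n (λ u → ΣVec k′ n (λ v → [ does (v ≟ᵛ ψ u) ] * w u))
      ≡⟨ ΣList-cong (allVecs k n) (λ u → ΣVec-pick k′ n (ψ u) (λ _ → w u)) ⟩
    ΣVec k n w
      ∎
    where
    open ≡-Reasoning
    inverse : ∀ u v → u ≡ φ v ⇔ v ≡ ψ u
    inverse u v = mk⇔ (λ u≡φv → trans (sym (ψφ v)) (cong ψ (sym u≡φv)))
                      (λ v≡ψu → trans (sym (φψ u)) (cong φ (sym v≡ψu)))

  ∑< : ℕ → (ℕ → ℕ) → ℕ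
  ∑< zero    f = 0
  ∑< (suc m) f = ∑< m f + f m

  infix 5 ∑<
  syntax ∑< m (λ k → e) = ∑[ k < m ] e

  ∑-cong : ∀ m {f g : ℕ → ℕ} → (∀ k → k < m → f k ≡ g k) → ∑< m f ≡ ∑< m g
  ∑-cong zero    f≗g = refl
  ∑-cong (suc m) f≗g = cong₂ _+_ (∑-cong m (λ k k<m → f≗g k (m<n⇒m<1+n k<m))) (f≗g m (n<1+n m))

  ∑-zero : ∀ m {f : ℕ → ℕ} → (∀ k → k < m → f k ≡ 0) → ∑< m f ≡ 0
  ∑-zero zero    f≡0 = refl
  ∑-zero (suc m) f≡0 = cong₂ _+_ (∑-zero m (λ k k<m → f≡0 k (m<n⇒m<1+n k<m))) (f≡0 m (n<1+n m))

  ∑-pick : ∀ m {M} (h : ℕ → ℕ) → M < m → ∑[ k < m ] [ does (k ≟ M) ] * h k ≡ h M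
  ∑-pick (suc m) {M} h M<1+m with m≤n⇒m<n∨m≡n (s≤s⁻¹ M<1+m)
  ... | inj₁ M<m  = trans (cong₂ _+_ (∑-pick m h M<m) (cong (λ b → [ b ] * h m) (dec-false (m ≟ M) (>⇒≢ M<m))))
                          (+-identityʳ (h M))
  ... | inj₂ refl = cong₂ _+_ (∑-zero M (λ k k<M → cong (λ b → [ b ] * h k) (dec-false (k ≟ M) (<⇒≢ k<M))))
                              (trans (cong (λ b → [ b ] * h M) (dec-true (M ≟ M) refl)) (+-identityʳ (h M)))

  ΣList-∑ : ∀ (xs : List A) m (f : ℕ → A → ℕ) →
            ΣList xs (λ x → ∑[ k < m ] f k x) ≡ ∑[ k < m ] ΣList xs (f k)
  ΣList-∑ xs zero    f = ΣList-zero xs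
  ΣList-∑ xs (suc m) f = trans (ΣList-+ xs _ (f m)) (cong (_+ ΣList xs (f m)) (ΣList-∑ xs m f))

  allᵛ : ∀ {k} → (A → Bool) → Vec A k → Bool
  allᵛ p []ᵥ      = true
  allᵛ p (x ∷ᵥ u) = p x ∧ allᵛ p u

  ΣVec-restrict : ∀ {m n} (ι : Fin m → Fin n) (p : Fin n → Bool) →
                  (∀ (h : Fin n → ℕ) → ΣFin n (λ x → [ p x ] * h x) ≡ ΣFin m (h ∘ ι)) →
                  ∀ k (w : Vec (Fin n) k → ℕ) →
                  ΣVec k n (λ u → [ allᵛ p u ] * w u) ≡ ΣVec k m (λ u → w (Vec.map ι u))
  ΣVec-restrict ι p fibre zero    w = cong (_+ 0) (+-identityʳ (w []ᵥ))
  ΣVec-restrict {m} {n} ι p fibre (suc k) w = begin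
    ΣVec (suc k) n (λ u → [ allᵛ p u ] * w u)
      ≡⟨ ΣVec-suc k n _ ⟩
    ΣVec k n (λ v → ΣFin n (λ x → [ p x ∧ allᵛ p v ] * w (x ∷ᵥ v)))
      ≡⟨ ΣList-cong (allVecs k n) (λ v → trans (ΣFin-cong n (λ x → [∧]-*-comm (p x) (allᵛ p v) (w (x ∷ᵥ v))))
                                               (ΣList-*ˡ (allFin n) [ allᵛ p v ] _)) ⟩
    ΣVec k n (λ v → [ allᵛ p v ] * ΣFin n (λ x → [ p x ] * w (x ∷ᵥ v)))
      ≡⟨ ΣVec-restrict ι p fibre k _ ⟩
    ΣVec k m (λ u → ΣFin n (λ x → [ p x ] * w (x ∷ᵥ Vec.map ι u)))
      ≡⟨ ΣList-cong (allVecs k m) (λ u → fibre (λ x → w (x ∷ᵥ Vec.map ι u))) ⟩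
    ΣVec k m (λ u → ΣFin m (λ y → w (ι y ∷ᵥ Vec.map ι u)))
      ≡⟨ ΣVec-suc k m _ ⟨
    ΣVec (suc k) m (λ u → w (Vec.map ι u))
      ∎
    where open ≡-Reasoning

module StrictMaps where

  open Sums
  open import Data.Bool using (Bool; true; false; T; not; _∧_; _∨_)
  open import Data.Bool.Properties using (T-∧)
  open import Data.Bool.ListAction using (and)
  open import Data.Empty using (⊥-elim)
  open import Data.Fin using (Fin; toℕ; splitAt; join; _<_) renaming (zero to fzero; suc to fsuc)
  open import Data.Fin.Properties using (splitAt-join; toℕ<n)
  open import Data.List using (map; allFin)
  open import Data.List.Relation.Unary.All.Properties using (all⁺; all⁻; tabulate⁺; tabulate⁻)
  open import Data.Nat as ℕ using (suc; _<ᵇ_)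
  open import Data.Nat.Properties using (<ᵇ⇒<; <⇒<ᵇ)
  import Data.Nat.Properties as ℕₚ
  open import Data.Product using (_×_; _,_)
  open import Data.Sum using (_⊎_; inj₁; inj₂; [_,_]′)
  open import Data.Unit using (tt)
  open import Data.Vec as Vec using (Vec; lookup) renaming ([] to []ᵥ; _∷_ to _∷ᵥ_; _++_ to _++ᵥ_)
  open import Data.Vec.Properties using (lookup-splitAt; lookup-map; lookup∘tabulate)
  open import Function using (_∘_; Equivalence)
  open Equivalence using (to; from)
  open import Function.Bundles using (_⇔_; mk⇔; Inverse)
  open import Relation.Binary.PropositionalEquality hiding ([_])

  T-injective : ∀ {x y} → T x ⇔ T y → x ≡ y
  T-injective {false} {false} _   = refl
  T-injective {false} {true}  x⇔y = ⊥-elim (from x⇔y tt)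
  T-injective {true}  {false} x⇔y = ⊥-elim (to x⇔y tt)
  T-injective {true}  {true}  _   = refl

  T-⇒ : ∀ {x y} → T (not x ∨ y) ⇔ (T x → T y)
  T-⇒ {false} = mk⇔ (λ _ ()) (λ _ → tt)
  T-⇒ {true}  = mk⇔ (λ y _ → y) (λ x⇒y → x⇒y tt)

  T-<ᵇ : ∀ {m n} → T (m <ᵇ n) ⇔ m ℕ.< n
  T-<ᵇ {m} {n} = mk⇔ (<ᵇ⇒< m n) <⇒<ᵇ

  T-allFin : ∀ {n} (p : Fin n → Bool) → T (and (map p (allFin n))) ⇔ (∀ i → T (p i))
  T-allFin p = mk⇔ (tabulate⁻ ∘ all⁺ p _) (all⁻ p ∘ tabulate⁺)

  T-allᵛ : ∀ {A : Set} {k} (p : A → Bool) (u : Vec A k) → T (allᵛ p u) ⇔ (∀ i → T (p (lookup u i)))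
  T-allᵛ p []ᵥ      = mk⇔ (λ _ ()) (λ _ → tt)
  T-allᵛ p (x ∷ᵥ u) = mk⇔
    (λ t → let px , pu = to T-∧ t in
           λ { fzero → px ; (fsuc i) → to (T-allᵛ p u) pu i })
    (λ h → from T-∧ (h fzero , from (T-allᵛ p u) (h ∘ fsuc)))

  Strict : (X : FinPoset) {n : ℕ} → Vec (Fin n) (size X) → Set
  Strict X g = ∀ a b → T (lt X a b) → lookup g a < lookup g b

  T-isStrict : ∀ X {n} (g : Vec (Fin n) (size X)) → T (isStrict X g) ⇔ Strict X g
  T-isStrict X g = mk⇔
    (λ s a b a<b → <ᵇ⇒< _ _ (to T-⇒ (to (T-allFin _) (to (T-allFin _) s a) b) a<b))
    (λ s → from (T-allFin _) λ a → from (T-allFin _) λ b →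
             from T-⇒ (<⇒<ᵇ ∘ s a b))

  module _ (c : Bool) (X Y : FinPoset) {n} (u : Vec (Fin n) (size X)) (v : Vec (Fin n) (size Y)) where

    private
      value : Fin (size X) ⊎ Fin (size Y) → Fin n
      value = [ lookup u , lookup v ]′

    StrictParts : Set
    StrictParts = (Strict X u × Strict Y v) × (T c → ∀ i j → lookup u i < lookup v j)

    Strict-glue : Strict (glue c X Y) (u ++ᵥ v) ⇔ StrictParts
    Strict-glue = mk⇔ split combine
      where
      onSummands : Strict (glue c X Y) (u ++ᵥ v) →
                   ∀ p q → T (sumLt c (lt X) (lt Y) p q) → value p < value q
      onSummands s p q = subst₂ (λ p′ q′ → T (sumLt c (lt X) (lt Y) p′ q′) → value p′ < value q′)
        (splitAt-join (size X) (size Y) p) (splitAt-join (size X) (size Y) q)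
        (subst₂ _<_ (lookup-splitAt (size X) u v (join _ _ p)) (lookup-splitAt (size X) u v (join _ _ q))
          ∘ s (join _ _ p) (join _ _ q))
      split : Strict (glue c X Y) (u ++ᵥ v) → StrictParts
      split s = ((λ a b → onSummands s (inj₁ a) (inj₁ b)) , (λ a b → onSummands s (inj₂ a) (inj₂ b)))
           , (λ t i j → onSummands s (inj₁ i) (inj₂ j) t)
      combine : StrictParts → Strict (glue c X Y) (u ++ᵥ v)
      combine ((sX , sY) , below) a b a<b =
        subst₂ _<_ (sym (lookup-splitAt (size X) u v a)) (sym (lookup-splitAt (size X) u v b))
          (onSplit (splitAt (size X) a) (splitAt (size X) b) a<b)
        where
        onSplit : ∀ p q → T (sumLt c (lt X) (lt Y) p q) → value p < value q
        onSplit (inj₁ i) (inj₁ j) = sX i j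
        onSplit (inj₂ i) (inj₂ j) = sY i j
        onSplit (inj₁ i) (inj₂ j) = λ t → below t i j
        onSplit (inj₂ i) (inj₁ j) = λ ()

  isStrict-⊔ : ∀ X Y {n} (u : Vec (Fin n) (size X)) v →
               isStrict (X ⊔ Y) (u ++ᵥ v) ≡ isStrict X u ∧ isStrict Y v
  isStrict-⊔ X Y u v = T-injective (mk⇔
    (λ s → let (sX , sY) , _ = to (Strict-glue false X Y u v) (to (T-isStrict (X ⊔ Y) (u ++ᵥ v)) s)
           in from T-∧ (from (T-isStrict X u) sX , from (T-isStrict Y v) sY))
    (λ s → let sX , sY = to T-∧ s
           in from (T-isStrict (X ⊔ Y) (u ++ᵥ v)) (from (Strict-glue false X Y u v)
                ((to (T-isStrict X u) sX , to (T-isStrict Y v) sY) , λ ()))))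

  T-not-<ᵇ : ∀ {m n} → T (not (m <ᵇ n)) ⇔ n ℕ.≤ m
  T-not-<ᵇ {m} {n} with m <ᵇ n in eq
  ... | true  = mk⇔ (λ ()) (λ n≤m → ℕₚ.≤⇒≯ n≤m (<ᵇ⇒< m n (subst T (sym eq) tt)))
  ... | false = mk⇔ (λ _ → ℕₚ.≮⇒≥ (λ m<n → subst T eq (<⇒<ᵇ m<n))) (λ _ → tt)

  maxᵛ : ∀ {n k} → Vec (Fin n) k → ℕ
  maxᵛ []ᵥ      = 0
  maxᵛ (x ∷ᵥ u) = toℕ x ℕ.⊔ maxᵛ u

  lookup≤maxᵛ : ∀ {n k} (u : Vec (Fin n) k) i → toℕ (lookup u i) ℕ.≤ maxᵛ u
  lookup≤maxᵛ (x ∷ᵥ u) fzero    = ℕₚ.m≤m⊔n (toℕ x) (maxᵛ u)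
  lookup≤maxᵛ (x ∷ᵥ u) (fsuc i) = ℕₚ.≤-trans (lookup≤maxᵛ u i) (ℕₚ.m≤n⊔m (toℕ x) (maxᵛ u))

  maxᵛ-< : ∀ {n k} (u : Vec (Fin n) k) → 0 ℕ.< k → ∀ m →
           maxᵛ u ℕ.< m ⇔ (∀ i → toℕ (lookup u i) ℕ.< m)
  maxᵛ-< u 0<k m = mk⇔ (λ max<m i → ℕₚ.≤-<-trans (lookup≤maxᵛ u i) max<m) (lub u 0<k)
    where
    lub : ∀ {k} (u : Vec _ k) → 0 ℕ.< k → (∀ i → toℕ (lookup u i) ℕ.< m) → maxᵛ u ℕ.< m
    lub (x ∷ᵥ []ᵥ)     _ u<m = ℕₚ.⊔-lub (u<m fzero) (ℕₚ.≤-<-trans ℕ.z≤n (u<m fzero))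
    lub (x ∷ᵥ y ∷ᵥ u) _ u<m = ℕₚ.⊔-lub (u<m fzero) (lub (y ∷ᵥ u) ℕ.z<s (u<m ∘ fsuc))

  maxᵛ<n : ∀ {n k} (u : Vec (Fin n) k) → 0 ℕ.< k → maxᵛ u ℕ.< n
  maxᵛ<n {n} u 0<k = from (maxᵛ-< u 0<k n) (λ i → toℕ<n (lookup u i))

  allLt : ∀ {n k} → ℕ → Vec (Fin n) k → Bool
  allLt m = allᵛ (λ x → toℕ x <ᵇ m)

  allGe : ∀ {n k} → ℕ → Vec (Fin n) k → Bool
  allGe m = allᵛ (λ x → not (toℕ x <ᵇ m))

  allLt≡maxᵛ<ᵇ : ∀ {n k} (u : Vec (Fin n) k) → 0 ℕ.< k → ∀ m → allLt m u ≡ (maxᵛ u <ᵇ m)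
  allLt≡maxᵛ<ᵇ u 0<k m = T-injective (mk⇔
    (λ t → from T-<ᵇ (from (maxᵛ-< u 0<k m) (λ i → to T-<ᵇ (to (T-allᵛ _ u) t i))))
    (λ t → from (T-allᵛ _ u) (λ i → from T-<ᵇ (to (maxᵛ-< u 0<k m) (to T-<ᵇ t) i))))

  allGe-maxᵛ : ∀ {n k l} (u : Vec (Fin n) k) (v : Vec (Fin n) l) → 0 ℕ.< k →
               T (allGe (suc (maxᵛ u)) v) ⇔ (∀ i j → lookup u i < lookup v j)
  allGe-maxᵛ u v 0<k = mk⇔
    (λ t i j → to (maxᵛ-< u 0<k _) (to T-not-<ᵇ (to (T-allᵛ _ v) t j)) i)
    (λ u<v → from (T-allᵛ _ v) (λ j → from T-not-<ᵇ (from (maxᵛ-< u 0<k _) (λ i → u<v i j))))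

  isStrict-✶ : ∀ X Y {n} (u : Vec (Fin n) (size X)) v → 0 ℕ.< size X →
               isStrict (X ✶ Y) (u ++ᵥ v) ≡ (isStrict X u ∧ isStrict Y v) ∧ allGe (suc (maxᵛ u)) v
  isStrict-✶ X Y u v 0<size = T-injective (mk⇔
    (λ s → let (sX , sY) , below = to (Strict-glue true X Y u v) (to (T-isStrict (X ✶ Y) (u ++ᵥ v)) s)
           in from T-∧ (from T-∧ (from (T-isStrict X u) sX , from (T-isStrict Y v) sY) ,
                        from (allGe-maxᵛ u v 0<size) (below tt)))
    (λ s → let sXY , above = to T-∧ s ; sX , sY = to T-∧ sXY
           in from (T-isStrict (X ✶ Y) (u ++ᵥ v)) (from (Strict-glue true X Y u v)
                ((to (T-isStrict X u) sX , to (T-isStrict Y v) sY) , λ _ → to (allGe-maxᵛ u v 0<size) above))))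

  isStrict-map : ∀ X {m n} (ι : Fin m → Fin n) → (∀ x y → ι x < ι y ⇔ x < y) →
                 ∀ u → isStrict X (Vec.map ι u) ≡ isStrict X u
  isStrict-map X ι ι-<⇔ u = T-injective (mk⇔
    (λ s → from (T-isStrict X u) λ a b a<b →
             to (ι-<⇔ _ _) (subst₂ _<_ (lookup-map a ι u) (lookup-map b ι u) (to (T-isStrict X (Vec.map ι u)) s a b a<b)))
    (λ s → from (T-isStrict X (Vec.map ι u)) λ a b a<b →
             subst₂ _<_ (sym (lookup-map a ι u)) (sym (lookup-map b ι u))
               (from (ι-<⇔ _ _) (to (T-isStrict X u) s a b a<b))))

  isStrict-≅ : ∀ {X Y} ((e , pres) : X ≅ Y) {n} (v : Vec (Fin n) (size Y)) →
               isStrict X (Vec.tabulate (lookup v ∘ Inverse.to e)) ≡ isStrict Y v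
  isStrict-≅ {X} {Y} (e , pres) v = T-injective (mk⇔
    (λ s → from (T-isStrict Y v) λ a b a<b →
             subst₂ _<_ (lookup-transported a) (lookup-transported b)
               (to (T-isStrict X transported) s (σ⁻¹ a) (σ⁻¹ b)
                 (subst T (sym (trans (pres (σ⁻¹ a) (σ⁻¹ b)) (cong₂ (lt Y) (σσ⁻¹ a) (σσ⁻¹ b)))) a<b)))
    (λ s → from (T-isStrict X transported) λ a b a<b →
             subst₂ _<_ (sym (lookup∘tabulate _ a)) (sym (lookup∘tabulate _ b))
               (to (T-isStrict Y v) s (σ a) (σ b) (subst T (pres a b) a<b))))
    where
    σ : Fin (size X) → Fin (size Y)
    σ = Inverse.to e
    σ⁻¹ : Fin (size Y) → Fin (size X)
    σ⁻¹ = Inverse.from e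
    σσ⁻¹ : ∀ y → σ (σ⁻¹ y) ≡ y
    σσ⁻¹ = Inverse.strictlyInverseˡ e
    transported : Vec (Fin _) (size X)
    transported = Vec.tabulate (lookup v ∘ σ)
    lookup-transported : ∀ y → lookup transported (σ⁻¹ y) ≡ lookup v y
    lookup-transported y = trans (lookup∘tabulate _ (σ⁻¹ y)) (cong (lookup v) (σσ⁻¹ y))

module Counting where

  open Sums
  open StrictMaps
  open import Data.Bool using (not; _∧_)
  open import Data.Fin using (Fin; toℕ; _↑ˡ_; _↑ʳ_; _<_) renaming (zero to fzero; suc to fsuc)
  open import Data.Fin.Properties using (toℕ-↑ˡ; toℕ-↑ʳ)
  open import Data.List using (allFin)
  open import Data.Nat as ℕ using (zero; suc; _+_; _*_; _∸_; _≤_; _<ᵇ_; _≟_)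
  open import Data.Nat.Properties
  open import Data.Nat.Tactic.RingSolver using (solve-∀)
  open import Data.Product using (_,_)
  open import Data.Vec as Vec using (Vec; lookup) renaming ([] to []ᵥ; _∷_ to _∷ᵥ_; _++_ to _++ᵥ_)
  open import Data.Vec.Properties using (lookup∘tabulate; tabulate∘lookup; tabulate-cong)
  open import Function using (_∘_)
  open import Function.Bundles using (_⇔_; mk⇔; Inverse)
  open import Relation.Nullary using (does)
  open import Relation.Binary.PropositionalEquality hiding ([_])

  Ω°-𝟏 : ∀ n → Ω° 𝟏 n ≡ n
  Ω°-𝟏 n = trans (ΣVec-suc 0 n _) (trans (+-identityʳ _) (trans (ΣFin-const n 1) (*-identityʳ n)))

  Ω°-⊔ : ∀ X Y n → Ω° (X ⊔ Y) n ≡ Ω° X n * Ω° Y n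
  Ω°-⊔ X Y n = begin
    Ω° (X ⊔ Y) n
      ≡⟨ ΣVec-++ (size X) (size Y) n _ ⟩
    ΣVec (size X) n (λ u → ΣVec (size Y) n (λ v → [ isStrict (X ⊔ Y) (u ++ᵥ v) ]))
      ≡⟨ ΣList-cong (allVecs (size X) n) (λ u → ΣList-cong (allVecs (size Y) n) (λ v →
           trans (cong [_] (isStrict-⊔ X Y u v)) ([∧] (isStrict X u) (isStrict Y v)))) ⟩
    ΣVec (size X) n (λ u → ΣVec (size Y) n (λ v → [ isStrict X u ] * [ isStrict Y v ]))
      ≡⟨ ΣList-cong (allVecs (size X) n) (λ u →
           trans (ΣList-*ˡ (allVecs (size Y) n) [ isStrict X u ] (λ v → [ isStrict Y v ]))
                 (*-comm [ isStrict X u ] (Ω° Y n))) ⟩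
    ΣVec (size X) n (λ u → Ω° Y n * [ isStrict X u ])
      ≡⟨ ΣList-*ˡ (allVecs (size X) n) (Ω° Y n) (λ u → [ isStrict X u ]) ⟩
    Ω° Y n * Ω° X n
      ≡⟨ *-comm (Ω° Y n) (Ω° X n) ⟩
    Ω° X n * Ω° Y n
      ∎
    where open ≡-Reasoning

  Ω°-≅ : ∀ {X Y} → X ≅ Y → ∀ n → Ω° X n ≡ Ω° Y n
  Ω°-≅ {X} {Y} (e , pres) n = begin
    Ω° X n
      ≡⟨ ΣVec-reindex φ ψ φψ ψφ (λ g → [ isStrict X g ]) ⟨
    ΣVec (size Y) n (λ v → [ isStrict X (φ v) ])
      ≡⟨ ΣList-cong (allVecs (size Y) n) (λ v → cong [_] (isStrict-≅ {X} {Y} (e , pres) v)) ⟩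
    Ω° Y n
      ∎
    where
    open ≡-Reasoning
    open Inverse e using (to; from; strictlyInverseˡ; strictlyInverseʳ)
    φ : Vec (Fin n) (size Y) → Vec (Fin n) (size X)
    φ v = Vec.tabulate (lookup v ∘ to)
    ψ : Vec (Fin n) (size X) → Vec (Fin n) (size Y)
    ψ u = Vec.tabulate (lookup u ∘ from)
    ψφ : ∀ v → ψ (φ v) ≡ v
    ψφ v = trans (tabulate-cong (λ j → trans (lookup∘tabulate _ (from j)) (cong (lookup v) (strictlyInverseˡ j))))
                 (tabulate∘lookup v)
    φψ : ∀ u → φ (ψ u) ≡ u
    φψ u = trans (tabulate-cong (λ i → trans (lookup∘tabulate _ (to i)) (cong (lookup u) (strictlyInverseʳ i))))
                 (tabulate∘lookup u)

  fibre-↑ˡ : ∀ m r (h : Fin (m + r) → ℕ) →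
             ΣFin (m + r) (λ x → [ toℕ x <ᵇ m ] * h x) ≡ ΣFin m (h ∘ (_↑ˡ r))
  fibre-↑ˡ zero    r h = ΣList-zero (allFin r)
  fibre-↑ˡ (suc m) r h = trans (ΣFin-suc (m + r) (λ x → [ toℕ x <ᵇ suc m ] * h x))
    (trans (cong₂ _+_ (+-identityʳ (h fzero)) (fibre-↑ˡ m r (h ∘ fsuc))) (sym (ΣFin-suc m (h ∘ (_↑ˡ r)))))

  fibre-↑ʳ : ∀ j r (h : Fin (j + r) → ℕ) →
             ΣFin (j + r) (λ x → [ not (toℕ x <ᵇ j) ] * h x) ≡ ΣFin r (h ∘ (j ↑ʳ_))
  fibre-↑ʳ zero    r h = ΣFin-cong r (λ x → +-identityʳ (h x))
  fibre-↑ʳ (suc j) r h =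
    trans (ΣFin-suc (j + r) (λ x → [ not (toℕ x <ᵇ suc j) ] * h x)) (fibre-↑ʳ j r (h ∘ fsuc))

  Ω°-below : ∀ X {m n} → m ≤ n → ΣVec (size X) n (λ u → [ allLt m u ] * [ isStrict X u ]) ≡ Ω° X m
  Ω°-below X {m} m≤n with m≤n⇒∃[o]m+o≡n m≤n
  ... | r , refl = trans (ΣVec-restrict (_↑ˡ r) _ (fibre-↑ˡ m r) (size X) (λ u → [ isStrict X u ]))
    (ΣList-cong (allVecs (size X) m) (cong [_] ∘ isStrict-map X (_↑ˡ r) ↑ˡ-<⇔))
    where
    ↑ˡ-<⇔ : ∀ x y → x ↑ˡ r < y ↑ˡ r ⇔ x < y
    ↑ˡ-<⇔ x y = mk⇔ (subst₂ ℕ._<_ (toℕ-↑ˡ x r) (toℕ-↑ˡ y r))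
                    (subst₂ ℕ._<_ (sym (toℕ-↑ˡ x r)) (sym (toℕ-↑ˡ y r)))

  Ω°-above : ∀ X {j n} → j ≤ n → ΣVec (size X) n (λ v → [ allGe j v ] * [ isStrict X v ]) ≡ Ω° X (n ∸ j)
  Ω°-above X {j} j≤n with m≤n⇒∃[o]m+o≡n j≤n
  ... | r , refl = trans (ΣVec-restrict (j ↑ʳ_) _ (fibre-↑ʳ j r) (size X) (λ v → [ isStrict X v ]))
    (trans (ΣList-cong (allVecs (size X) r) (cong [_] ∘ isStrict-map X (j ↑ʳ_) ↑ʳ-<⇔))
           (cong (Ω° X) (sym (m+n∸m≡n j r))))
    where
    ↑ʳ-<⇔ : ∀ x y → j ↑ʳ x < j ↑ʳ y ⇔ x < y
    ↑ʳ-<⇔ x y = mk⇔ (+-cancelˡ-< j _ _ ∘ subst₂ ℕ._<_ (toℕ-↑ʳ j x) (toℕ-↑ʳ j y))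
                    (subst₂ ℕ._<_ (sym (toℕ-↑ʳ j x)) (sym (toℕ-↑ʳ j y)) ∘ +-monoʳ-< j)

  [<ᵇ-suc] : ∀ M k → [ M <ᵇ suc k ] ≡ [ does (k ≟ M) ] + [ M <ᵇ k ]
  [<ᵇ-suc] zero    zero    = refl
  [<ᵇ-suc] zero    (suc k) = refl
  [<ᵇ-suc] (suc M) zero    = refl
  [<ᵇ-suc] (suc M) (suc k) = [<ᵇ-suc] M k

  -- The strict maps into 𝐧 with maximum k are those into 𝐤+𝟏 but not into 𝐤.
  Ω°-max : ∀ X {k n} → k ℕ.< n → 0 ℕ.< size X →
           ΣVec (size X) n (λ u → [ does (k ≟ maxᵛ u) ] * [ isStrict X u ]) + Ω° X k ≡ Ω° X (suc k)
  Ω°-max X {k} {n} k<n 0<size = begin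
    ΣVec (size X) n maxIs-k + Ω° X k
      ≡⟨ cong (ΣVec (size X) n maxIs-k +_) (Ω°-below X (<⇒≤ k<n)) ⟨
    ΣVec (size X) n maxIs-k + ΣVec (size X) n below-k
      ≡⟨ ΣList-+ (allVecs (size X) n) maxIs-k below-k ⟨
    ΣVec (size X) n (λ u → maxIs-k u + below-k u)
      ≡⟨ ΣList-cong (allVecs (size X) n) split ⟨
    ΣVec (size X) n (λ u → [ allLt (suc k) u ] * [ isStrict X u ])
      ≡⟨ Ω°-below X k<n ⟩
    Ω° X (suc k)
      ∎
    where
    open ≡-Reasoning
    maxIs-k below-k : Vec (Fin n) (size X) → ℕ
    maxIs-k u = [ does (k ≟ maxᵛ u) ] * [ isStrict X u ]
    below-k u = [ allLt k u ] * [ isStrict X u ]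
    split : ∀ u → [ allLt (suc k) u ] * [ isStrict X u ] ≡ maxIs-k u + below-k u
    split u = begin
      [ allLt (suc k) u ] * [ isStrict X u ]
        ≡⟨ cong (λ b → [ b ] * [ isStrict X u ]) (allLt≡maxᵛ<ᵇ u 0<size (suc k)) ⟩
      [ maxᵛ u <ᵇ suc k ] * [ isStrict X u ]
        ≡⟨ cong (_* [ isStrict X u ]) ([<ᵇ-suc] (maxᵛ u) k) ⟩
      ([ does (k ≟ maxᵛ u) ] + [ maxᵛ u <ᵇ k ]) * [ isStrict X u ]
        ≡⟨ *-distribʳ-+ [ isStrict X u ] [ does (k ≟ maxᵛ u) ] [ maxᵛ u <ᵇ k ] ⟩
      maxIs-k u + [ maxᵛ u <ᵇ k ] * [ isStrict X u ]
        ≡⟨ cong (λ b → maxIs-k u + [ b ] * [ isStrict X u ]) (allLt≡maxᵛ<ᵇ u 0<size k) ⟨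
      maxIs-k u + below-k u
        ∎

  Ω°-✶-byMax : ∀ X Y n → 0 ℕ.< size X →
               Ω° (X ✶ Y) n ≡ ΣVec (size X) n (λ u → [ isStrict X u ] * Ω° Y (n ∸ suc (maxᵛ u)))
  Ω°-✶-byMax X Y n 0<size = trans (ΣVec-++ (size X) (size Y) n _) (ΣList-cong (allVecs (size X) n) λ u → begin
    ΣVec (size Y) n (λ v → [ isStrict (X ✶ Y) (u ++ᵥ v) ])
      ≡⟨ ΣList-cong (allVecs (size Y) n) (λ v → trans (cong [_] (isStrict-✶ X Y u v 0<size))
                                                   (regroup (isStrict X u) (isStrict Y v) (allGe (suc (maxᵛ u)) v))) ⟩
    ΣVec (size Y) n (λ v → [ isStrict X u ] * ([ allGe (suc (maxᵛ u)) v ] * [ isStrict Y v ]))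
      ≡⟨ ΣList-*ˡ (allVecs (size Y) n) [ isStrict X u ] (λ v → [ allGe (suc (maxᵛ u)) v ] * [ isStrict Y v ]) ⟩
    [ isStrict X u ] * ΣVec (size Y) n (λ v → [ allGe (suc (maxᵛ u)) v ] * [ isStrict Y v ])
      ≡⟨ cong ([ isStrict X u ] *_) (Ω°-above Y (maxᵛ<n u 0<size)) ⟩
    [ isStrict X u ] * Ω° Y (n ∸ suc (maxᵛ u))
      ∎)
    where
    open ≡-Reasoning
    regroup : ∀ a b c → [ (a ∧ b) ∧ c ] ≡ [ a ] * ([ c ] * [ b ])
    regroup a b c = trans ([∧] (a ∧ b) c) (trans (cong (_* [ c ]) ([∧] a b)) (reassoc [ a ] [ b ] [ c ]))
      where
      reassoc : ∀ x y z → x * y * z ≡ x * (z * y)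
      reassoc = solve-∀

  -- Truncated subtraction is harmless here: Ω° X is monotone (see Ω°-max).
  Ω°-✶ : ∀ X Y n → 0 ℕ.< size X →
         Ω° (X ✶ Y) n ≡ ∑[ k < n ] (Ω° X (suc k) ∸ Ω° X k) * Ω° Y (n ∸ suc k)
  Ω°-✶ X Y n 0<size = begin
    Ω° (X ✶ Y) n
      ≡⟨ Ω°-✶-byMax X Y n 0<size ⟩
    ΣVec (size X) n (λ u → [ isStrict X u ] * Ω° Y (n ∸ suc (maxᵛ u)))
      ≡⟨ ΣList-cong (allVecs (size X) n) (λ u →
           ∑-pick n (λ k → [ isStrict X u ] * Ω° Y (n ∸ suc k)) (maxᵛ<n u 0<size)) ⟨
    ΣVec (size X) n (λ u → ∑[ k < n ] [ does (k ≟ maxᵛ u) ] * ([ isStrict X u ] * Ω° Y (n ∸ suc k)))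
      ≡⟨ ΣList-∑ (allVecs (size X) n) n _ ⟩
    ∑[ k < n ] ΣVec (size X) n (λ u → [ does (k ≟ maxᵛ u) ] * ([ isStrict X u ] * Ω° Y (n ∸ suc k)))
      ≡⟨ ∑-cong n (λ k k<n → countAtMax k k<n) ⟩
    ∑[ k < n ] (Ω° X (suc k) ∸ Ω° X k) * Ω° Y (n ∸ suc k)
      ∎
    where
    open ≡-Reasoning
    countAtMax : ∀ k → k ℕ.< n →
      ΣVec (size X) n (λ u → [ does (k ≟ maxᵛ u) ] * ([ isStrict X u ] * Ω° Y (n ∸ suc k)))
        ≡ (Ω° X (suc k) ∸ Ω° X k) * Ω° Y (n ∸ suc k)
    countAtMax k k<n = begin
      ΣVec (size X) n (λ u → [ does (k ≟ maxᵛ u) ] * ([ isStrict X u ] * Ω° Y (n ∸ suc k)))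
        ≡⟨ ΣList-cong (allVecs (size X) n) (λ u →
             rotate [ does (k ≟ maxᵛ u) ] [ isStrict X u ] (Ω° Y (n ∸ suc k))) ⟩
      ΣVec (size X) n (λ u → Ω° Y (n ∸ suc k) * ([ does (k ≟ maxᵛ u) ] * [ isStrict X u ]))
        ≡⟨ ΣList-*ˡ (allVecs (size X) n) (Ω° Y (n ∸ suc k)) _ ⟩
      Ω° Y (n ∸ suc k) * ΣVec (size X) n (λ u → [ does (k ≟ maxᵛ u) ] * [ isStrict X u ])
        ≡⟨ cong (Ω° Y (n ∸ suc k) *_)
             (trans (sym (m+n∸n≡m _ (Ω° X k))) (cong (_∸ Ω° X k) (Ω°-max X k<n 0<size))) ⟩
      Ω° Y (n ∸ suc k) * (Ω° X (suc k) ∸ Ω° X k)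
        ≡⟨ *-comm (Ω° Y (n ∸ suc k)) _ ⟩
      (Ω° X (suc k) ∸ Ω° X k) * Ω° Y (n ∸ suc k)
        ∎
      where
      rotate : ∀ a b c → a * (b * c) ≡ c * (a * b)
      rotate = solve-∀

module WixarikaDegree where

  open FiniteDifferences
  open Sums using (∑<; ∑-cong)
  open Counting
  open import Data.Integer using (ℤ; +_; _+_; _-_; _*_)
  open import Data.Integer.Properties using (pos-+; pos-*; m-n≡m⊖n; ⊖-≥; *-identityʳ)
  open import Data.Nat as ℕ using (zero; suc; _∸_; z<s)
  import Data.Nat.Properties as ℕₚ
  open import Data.Product using (∃; _,_)
  open import Function using (_∘_)
  open import Relation.Binary.PropositionalEquality

  Ωℤ : FinPoset → ℕ → ℤ
  Ωℤ X n = + Ω° X n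

  conv-pos : ∀ (e g : ℕ → ℕ) n → conv (+_ ∘ e) (+_ ∘ g) n ≡ + (∑[ k < n ] e k ℕ.* g (n ∸ suc k))
  conv-pos e g zero    = refl
  conv-pos e g (suc n) = begin
    + e n * + g 0 + conv (+_ ∘ e) (+_ ∘ g ∘ suc) n
      ≡⟨ cong₂ _+_ (sym (pos-* (e n) (g 0))) (conv-pos e (g ∘ suc) n) ⟩
    + (e n ℕ.* g 0) + + (∑[ k < n ] e k ℕ.* g (suc (n ∸ suc k)))
      ≡⟨ sym (pos-+ (e n ℕ.* g 0) _) ⟩
    + (e n ℕ.* g 0 ℕ.+ (∑[ k < n ] e k ℕ.* g (suc (n ∸ suc k))))
      ≡⟨ cong +_ (ℕₚ.+-comm (e n ℕ.* g 0) _) ⟩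
    + ((∑[ k < n ] e k ℕ.* g (suc (n ∸ suc k))) ℕ.+ e n ℕ.* g 0)
      ≡⟨ cong +_ (cong₂ ℕ._+_ (∑-cong n (λ k k<n → cong (λ i → e k ℕ.* g i) (sym (ℕₚ.+-∸-assoc 1 k<n))))
                               (cong (λ i → e n ℕ.* g i) (sym (ℕₚ.n∸n≡0 n)))) ⟩
    + (∑[ k < suc n ] e k ℕ.* g (suc n ∸ suc k))
      ∎
    where open ≡-Reasoning

  Ω°-mono : ∀ X k → 0 ℕ.< size X → Ω° X k ℕ.≤ Ω° X (suc k)
  Ω°-mono X k 0<size = subst (Ω° X k ℕ.≤_) (Ω°-max X (ℕₚ.n<1+n k) 0<size) (ℕₚ.m≤n+m _ _)

  Δ-Ωℤ : ∀ X → 0 ℕ.< size X → ∀ k → Δ (Ωℤ X) k ≡ + (Ω° X (suc k) ∸ Ω° X k)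
  Δ-Ωℤ X 0<size k = trans (m-n≡m⊖n (Ω° X (suc k)) (Ω° X k)) (⊖-≥ (Ω°-mono X k 0<size))

  Ωℤ-✶ : ∀ X Y → 0 ℕ.< size X → conv (Δ (Ωℤ X)) (Ωℤ Y) ≗ Ωℤ (X ✶ Y)
  Ωℤ-✶ X Y 0<size n = begin
    conv (Δ (Ωℤ X)) (Ωℤ Y) n
      ≡⟨ conv-congˡ (Ωℤ Y) (Δ-Ωℤ X 0<size) n ⟩
    conv (λ k → + (Ω° X (suc k) ∸ Ω° X k)) (Ωℤ Y) n
      ≡⟨ conv-pos (λ k → Ω° X (suc k) ∸ Ω° X k) (Ω° Y) n ⟩
    + (∑[ k < n ] (Ω° X (suc k) ∸ Ω° X k) ℕ.* Ω° Y (n ∸ suc k))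
      ≡⟨ cong +_ (Ω°-✶ X Y n 0<size) ⟨
    Ωℤ (X ✶ Y) n
      ∎
    where open ≡-Reasoning

  Ωℤ-𝟏 : ConstDiff 1 (+ 1) (Ωℤ 𝟏)
  Ωℤ-𝟏 = ConstDiff-cong 1 (λ n → trans (*-identityʳ (+ n)) (cong +_ (sym (Ω°-𝟏 n))))
                          (ConstDiff-*id 0 {f = λ _ → + 1} (λ _ → refl))

  Ωℤ-𝟏⊔ : ∀ X k {c} → ConstDiff k c (Ωℤ X) → ConstDiff (suc k) (+ suc k * c) (Ωℤ (𝟏 ⊔ X))
  Ωℤ-𝟏⊔ X k p = ConstDiff-cong (suc k) pointwise (ConstDiff-*id k p)
    where
    pointwise : (λ n → + n * Ωℤ X n) ≗ Ωℤ (𝟏 ⊔ X)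
    pointwise n = trans (sym (pos-* n (Ω° X n)))
                        (cong +_ (sym (trans (Ω°-⊔ 𝟏 X n) (cong (ℕ._* Ω° X n) (Ω°-𝟏 n)))))

  Ωℤ-✶-ConstDiff : ∀ X Y {a b c e} → 0 ℕ.< size X → ConstDiff (suc a) c (Ωℤ X) → ConstDiff b e (Ωℤ Y) →
                   ConstDiff (suc (a ℕ.+ b)) (c * e) (Ωℤ (X ✶ Y))
  Ωℤ-✶-ConstDiff X Y {a} {b} {c} {e} 0<size p q =
    subst (λ n → ConstDiff (suc n) (c * e) (Ωℤ (X ✶ Y))) (ℕₚ.+-comm b a)
      (ConstDiff-cong (suc (b ℕ.+ a)) (Ωℤ-✶ X Y 0<size) (ConstDiff-conv b p q))

  size-suc : ∀ t → ∃ λ a → size ⟦ t ⟧ ≡ suc a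
  size-suc one     = 0 , refl
  size-suc (d t)   = _ , refl
  size-suc (s · t) with size-suc s
  ... | a , eq = a ℕ.+ size ⟦ t ⟧ , cong (ℕ._+ size ⟦ t ⟧) eq

  Ωℤ-wixarika : ∀ t → ∃ λ c → ConstDiff (size ⟦ t ⟧) (+ suc c) (Ωℤ ⟦ t ⟧)
  Ωℤ-wixarika one = 0 , Ωℤ-𝟏
  Ωℤ-wixarika (d t) with Ωℤ-wixarika t
  ... | c , p = _ , Ωℤ-✶-ConstDiff 𝟏 W {a = 0} {b = size W} {c = + 1} {e = (+ suc n * + suc c) * + 1} z<s Ωℤ-𝟏
                      (Ωℤ-✶-ConstDiff (𝟏 ⊔ ⟦ t ⟧) 𝟏 {a = n} {b = 1} {c = + suc n * + suc c} {e = + 1} z<s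
                                      (Ωℤ-𝟏⊔ ⟦ t ⟧ n p) Ωℤ-𝟏)
    where
    n : ℕ
    n = size ⟦ t ⟧
    W : FinPoset
    W = (𝟏 ⊔ ⟦ t ⟧) ✶ 𝟏
  Ωℤ-wixarika (s · t) with size-suc s | Ωℤ-wixarika s | Ωℤ-wixarika t
  ... | a , eq | c , p | e , q =
    _ , subst (λ n → ConstDiff n (+ suc c * + suc e) (Ωℤ (⟦ s ⟧ ✶ ⟦ t ⟧))) (cong (ℕ._+ size ⟦ t ⟧) (sym eq))
          (Ωℤ-✶-ConstDiff ⟦ s ⟧ ⟦ t ⟧ {a = a} {b = size ⟦ t ⟧} (subst (0 ℕ.<_) (sym eq) z<s)
                          (subst (λ n → ConstDiff n (+ suc c) (Ωℤ ⟦ s ⟧)) eq p) q)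

module ZetaSeries where

  open FiniteDifferences
  open Sums using ([_]; ΣList; ΣList-++; ∑<; ∑-zero; ∑-pick)
  open import Data.Integer using (+_; 0ℤ; _+_; _-_; _*_)
  open import Data.Integer.Properties using (pos-+; pos-*)
  open import Data.Integer.Tactic.RingSolver using (solve-∀)
  open import Data.List using ([]; _∷_; length; applyUpTo; _∷ʳ_)
  open import Data.List.Properties using (applyUpTo-∷ʳ)
  open import Data.Nat as ℕ using (zero; suc; _∸_; _≤_; _≟_; z≤n; s≤s)
  import Data.Nat.Properties as ℕₚ
  open import Data.Nat.Combinatorics using (_C_; nCn≡1; k>n⇒nCk≡0; nCk+nC[k+1]≡[n+1]C[k+1])
  open import Relation.Nullary using (yes; no; does)
  open import Relation.Nullary.Decidable using (dec-false)
  open import Relation.Binary.PropositionalEquality hiding ([_])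

  ΣList-applyUpTo : ∀ {A : Set} (f : ℕ → A) n (w : A → ℕ) → ΣList (applyUpTo f n) w ≡ ∑[ k < n ] w (f k)
  ΣList-applyUpTo f zero    w = refl
  ΣList-applyUpTo f (suc n) w = begin
    ΣList (applyUpTo f (suc n)) w       ≡⟨ cong (λ xs → ΣList xs w) (applyUpTo-∷ʳ f n) ⟨
    ΣList (applyUpTo f n ∷ʳ f n) w      ≡⟨ ΣList-++ (applyUpTo f n) _ w ⟩
    ΣList (applyUpTo f n) w ℕ.+ (w (f n) ℕ.+ 0)
                                        ≡⟨ cong₂ ℕ._+_ (ΣList-applyUpTo f n w) (ℕₚ.+-identityʳ (w (f n))) ⟩
    (∑[ k < suc n ] w (f k))            ∎
    where open ≡-Reasoning

  ·ₛ-∑ : ∀ f g m → (f ·ₛ g) m ≡ ∑[ k < suc m ] f k ℕ.* g (m ∸ k)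
  ·ₛ-∑ f g m = ΣList-applyUpTo (λ k → k) (suc m) (λ k → f k ℕ.* g (m ∸ k))

  ∑-front : ∀ n (h : ℕ → ℕ) → ∑< (suc n) h ≡ h 0 ℕ.+ ∑< n (λ k → h (suc k))
  ∑-front zero    h = ℕₚ.+-comm 0 (h 0)
  ∑-front (suc n) h = trans (cong (ℕ._+ h (suc n)) (∑-front n h)) (ℕₚ.+-assoc (h 0) _ _)

  geom-·ₛ-zero : ∀ g → (geomₛ ·ₛ g) 0 ≡ g 0
  geom-·ₛ-zero g = trans (ℕₚ.+-identityʳ _) (ℕₚ.+-identityʳ (g 0))

  geom-·ₛ-suc : ∀ g m → (geomₛ ·ₛ g) (suc m) ≡ g (suc m) ℕ.+ (geomₛ ·ₛ g) m
  geom-·ₛ-suc g m = begin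
    (geomₛ ·ₛ g) (suc m)                           ≡⟨ ·ₛ-∑ geomₛ g (suc m) ⟩
    ∑< (suc (suc m)) (λ k → 1 ℕ.* g (suc m ∸ k))   ≡⟨ ∑-front (suc m) _ ⟩
    1 ℕ.* g (suc m) ℕ.+ ∑< (suc m) (λ k → 1 ℕ.* g (m ∸ k))
                                                    ≡⟨ cong (1 ℕ.* g (suc m) ℕ.+_) (·ₛ-∑ geomₛ g m) ⟨
    1 ℕ.* g (suc m) ℕ.+ (geomₛ ·ₛ g) m              ≡⟨ cong (ℕ._+ (geomₛ ·ₛ g) m) (ℕₚ.*-identityˡ (g (suc m))) ⟩
    g (suc m) ℕ.+ (geomₛ ·ₛ g) m                    ∎
    where open ≡-Reasoning

  geom^-binomial : ∀ j m → (geomₛ ^ₛ suc j) m ≡ (j ℕ.+ m) C j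
  geom^-binomial zero    zero    = geom-·ₛ-zero oneₛ
  geom^-binomial zero    (suc m) = trans (geom-·ₛ-suc oneₛ m) (geom^-binomial zero m)
  geom^-binomial (suc j) zero    = begin
    (geomₛ ·ₛ (geomₛ ^ₛ suc j)) 0     ≡⟨ geom-·ₛ-zero (geomₛ ^ₛ suc j) ⟩
    (geomₛ ^ₛ suc j) 0                ≡⟨ geom^-binomial j 0 ⟩
    (j ℕ.+ 0) C j                     ≡⟨ cong (_C j) (ℕₚ.+-identityʳ j) ⟩
    j C j                             ≡⟨ trans (nCn≡1 j) (sym (nCn≡1 (suc j))) ⟩
    suc j C suc j                     ≡⟨ cong (_C suc j) (ℕₚ.+-identityʳ (suc j)) ⟨
    (suc j ℕ.+ 0) C suc j             ∎
    where open ≡-Reasoning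
  geom^-binomial (suc j) (suc m) = begin
    (geomₛ ·ₛ (geomₛ ^ₛ suc j)) (suc m)
      ≡⟨ geom-·ₛ-suc (geomₛ ^ₛ suc j) m ⟩
    (geomₛ ^ₛ suc j) (suc m) ℕ.+ (geomₛ ^ₛ suc (suc j)) m
      ≡⟨ cong₂ ℕ._+_ (geom^-binomial j (suc m)) (geom^-binomial (suc j) m) ⟩
    (j ℕ.+ suc m) C j ℕ.+ (suc j ℕ.+ m) C suc j
      ≡⟨ cong (λ n → (j ℕ.+ suc m) C j ℕ.+ n C suc j) (ℕₚ.+-suc j m) ⟨
    (j ℕ.+ suc m) C j ℕ.+ (j ℕ.+ suc m) C suc j
      ≡⟨ nCk+nC[k+1]≡[n+1]C[k+1] (j ℕ.+ suc m) j ⟩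
    (suc j ℕ.+ suc m) C suc j
      ∎
    where open ≡-Reasoning

  ζ-binomial : ∀ j m → ζ j m ≡ m C j
  ζ-binomial j m with j ℕ.≤? m
  ... | yes j≤m = begin
    ζ j m                                                   ≡⟨ ·ₛ-∑ (monoₛ j) (geomₛ ^ₛ suc j) m ⟩
    ∑[ k < suc m ] [ does (k ≟ j) ] ℕ.* (geomₛ ^ₛ suc j) (m ∸ k)
                                                            ≡⟨ ∑-pick (suc m) (λ k → (geomₛ ^ₛ suc j) (m ∸ k)) (s≤s j≤m) ⟩
    (geomₛ ^ₛ suc j) (m ∸ j)                                ≡⟨ geom^-binomial j (m ∸ j) ⟩
    (j ℕ.+ (m ∸ j)) C j                                     ≡⟨ cong (_C j) (ℕₚ.m+[n∸m]≡n j≤m) ⟩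
    m C j                                                   ∎
    where open ≡-Reasoning
  ... | no j≰m = trans (·ₛ-∑ (monoₛ j) (geomₛ ^ₛ suc j) m)
    (trans (∑-zero (suc m) (λ k k≤m → cong (λ b → [ b ] ℕ.* (geomₛ ^ₛ suc j) (m ∸ k))
                                           (dec-false (k ≟ j) (λ { refl → j≰m (ℕ.s≤s⁻¹ k≤m) }))))
           (sym (k>n⇒nCk≡0 (ℕₚ.≰⇒> j≰m))))

  ConstDiff-binomial : ∀ j → ConstDiff j (+ 1) (λ m → + (m C j))
  ConstDiff-binomial zero    m = refl
  ConstDiff-binomial (suc j) = ConstDiff-cong j Δ-binomial (ConstDiff-binomial j)
    where
    cancel : ∀ a b → a ≡ (a + b) - b
    cancel = solve-∀
    Δ-binomial : (λ m → + (m C j)) ≗ Δ (λ m → + (m C suc j))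
    Δ-binomial m = trans (cancel (+ (m C j)) (+ (m C suc j)))
      (cong (_- + (m C suc j)) (trans (sym (pos-+ (m C j) (m C suc j))) (cong +_ (nCk+nC[k+1]≡[n+1]C[k+1] m j))))

  ConstDiff-ζ : ∀ j → ConstDiff j (+ 1) (λ m → + ζ j m)
  ConstDiff-ζ j = ConstDiff-cong j (λ m → cong +_ (sym (ζ-binomial j m))) (ConstDiff-binomial j)

  fromCoeffs-degree : ∀ j ds → DegreeAtMost (j ℕ.+ length ds) (λ m → + fromCoeffs j ds m)
  fromCoeffs-degree j []       = DegreeAtMost-mono z≤n (degree≤ {leading = 0ℤ} λ _ → refl)
  fromCoeffs-degree j (c ∷ cs) =
    DegreeAtMost-cong (λ m → sym (pos-+ (c ℕ.* ζ j m) (fromCoeffs (suc j) cs m))) (DegreeAtMost-+ term rest)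
    where
    term : DegreeAtMost (j ℕ.+ suc (length cs)) (λ m → + (c ℕ.* ζ j m))
    term = DegreeAtMost-mono (ℕₚ.m≤m+n j _)
      (degree≤ (ConstDiff-cong j (λ m → sym (pos-* c (ζ j m)))
                                 (ConstDiff-*ˡ j (+ c) {f = λ m → + ζ j m} (ConstDiff-ζ j))))
    rest : DegreeAtMost (j ℕ.+ suc (length cs)) (λ m → + fromCoeffs (suc j) cs m)
    rest = subst (λ n → DegreeAtMost n (λ m → + fromCoeffs (suc j) cs m)) (sym (ℕₚ.+-suc j (length cs)))
                 (fromCoeffs-degree (suc j) cs)

module Isomorphism where

  open import Data.Bool.Properties using () renaming (_≟_ to _≟ᵇ_)
  open import Data.Fin using (Fin)
  open import Data.Fin.Properties using (all?) renaming (_≟_ to _≟ᶠ_)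
  open import Data.List using (map; allFin)
  open import Data.List.Membership.Propositional using (_∈_; lose)
  open import Data.List.Membership.Propositional.Properties using (∈-map⁺; ∈-concat⁺′; ∈-allFin)
  open import Data.List.Relation.Unary.Any as Any using (Any; here; any?)
  open import Data.Nat using (zero; suc)
  open import Data.Product using (_×_; _,_)
  open import Data.Vec as Vec using (Vec; lookup) renaming ([] to []ᵥ; _∷_ to _∷ᵥ_)
  open import Data.Vec.Properties using (lookup∘tabulate)
  open import Function using (_∘_; id)
  open import Function.Bundles using (Inverse; mk↔ₛ′)
  open import Level using (0ℓ)
  open import Relation.Binary.Bundles using (DecSetoid)
  open import Relation.Nullary using (Dec; _×-dec_)
  open import Relation.Nullary.Decidable using (map′)
  open import Relation.Binary.PropositionalEquality

  ≅-refl : ∀ {X} → X ≅ X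
  ≅-refl = mk↔ₛ′ id id (λ _ → refl) (λ _ → refl) , λ _ _ → refl

  ≅-sym : ∀ {X Y} → X ≅ Y → Y ≅ X
  ≅-sym {X} {Y} (e , pres) = mk↔ₛ′ from to strictlyInverseʳ strictlyInverseˡ , λ a b →
    trans (cong₂ (lt Y) (sym (strictlyInverseˡ a)) (sym (strictlyInverseˡ b))) (sym (pres (from a) (from b)))
    where open Inverse e

  ≅-trans : ∀ {X Y Z} → X ≅ Y → Y ≅ Z → X ≅ Z
  ≅-trans (e , p) (e′ , p′) =
    mk↔ₛ′ (Inverse.to e′ ∘ Inverse.to e) (Inverse.from e ∘ Inverse.from e′)
      (λ z → trans (cong (Inverse.to e′) (Inverse.strictlyInverseˡ e (Inverse.from e′ z)))
                   (Inverse.strictlyInverseˡ e′ z))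
      (λ x → trans (cong (Inverse.from e) (Inverse.strictlyInverseʳ e′ (Inverse.to e x))) (Inverse.strictlyInverseʳ e x))
    , λ a b → trans (p a b) (p′ (Inverse.to e a) (Inverse.to e b))

  ∈-allVecs : ∀ k n (v : Vec (Fin n) k) → v ∈ allVecs k n
  ∈-allVecs zero    n []ᵥ      = here refl
  ∈-allVecs (suc k) n (x ∷ᵥ v) =
    ∈-concat⁺′ (∈-map⁺ (_∷ᵥ v) (∈-allFin x)) (∈-map⁺ (λ w → map (_∷ᵥ w) (allFin n)) (∈-allVecs k n v))

  -- X ≅ Y presented by finite tables, so that isomorphisms can be searched for exhaustively.
  IsoTable : (X Y : FinPoset) → Vec (Fin (size Y)) (size X) → Vec (Fin (size X)) (size Y) → Set
  IsoTable X Y σ τ = (∀ i → lookup τ (lookup σ i) ≡ i) × (∀ j → lookup σ (lookup τ j) ≡ j)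
                   × (∀ a b → lt X a b ≡ lt Y (lookup σ a) (lookup σ b))

  isoTable? : ∀ X Y σ τ → Dec (IsoTable X Y σ τ)
  isoTable? X Y σ τ = all? (λ i → lookup τ (lookup σ i) ≟ᶠ i) ×-dec all? (λ j → lookup σ (lookup τ j) ≟ᶠ j)
                    ×-dec all? (λ a → all? (λ b → lt X a b ≟ᵇ lt Y (lookup σ a) (lookup σ b)))

  IsoTable⇒≅ : ∀ {X Y σ τ} → IsoTable X Y σ τ → X ≅ Y
  IsoTable⇒≅ {σ = σ} {τ} (τσ , στ , pres) = mk↔ₛ′ (lookup σ) (lookup τ) στ τσ , pres

  ≅⇒IsoTable : ∀ {X Y} ((e , _) : X ≅ Y) → IsoTable X Y (Vec.tabulate (Inverse.to e)) (Vec.tabulate (Inverse.from e))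
  ≅⇒IsoTable {X} {Y} (e , pres) =
      (λ i → trans (lookup∘tabulate from _) (trans (cong from (lookup∘tabulate to i)) (strictlyInverseʳ i)))
    , (λ j → trans (lookup∘tabulate to _) (trans (cong to (lookup∘tabulate from j)) (strictlyInverseˡ j)))
    , (λ a b → trans (pres a b) (sym (cong₂ (lt Y) (lookup∘tabulate to a) (lookup∘tabulate to b))))
    where open Inverse e

  _≅?_ : ∀ X Y → Dec (X ≅ Y)
  X ≅? Y = map′ fromTables toTables
    (any? (λ σ → any? (isoTable? X Y σ) (allVecs (size Y) (size X))) (allVecs (size X) (size Y)))
    where
    Tables : Set
    Tables = Any (λ σ → Any (IsoTable X Y σ) (allVecs (size Y) (size X))) (allVecs (size X) (size Y))
    fromTables : Tables → X ≅ Y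
    fromTables tables with Any.satisfied tables
    ... | σ , τs with Any.satisfied τs
    ... | τ , table = IsoTable⇒≅ {X} {Y} {σ} {τ} table
    toTables : X ≅ Y → Tables
    toTables (e , pres) = lose (∈-allVecs (size X) (size Y) (Vec.tabulate (Inverse.to e)))
                               (lose (∈-allVecs (size Y) (size X) (Vec.tabulate (Inverse.from e)))
                                     (≅⇒IsoTable {X} {Y} (e , pres)))

  ≅-decSetoid : DecSetoid 0ℓ 0ℓ
  ≅-decSetoid = record
    { Carrier = FinPoset
    ; _≈_     = _≅_
    ; isDecEquivalence = record
      { isEquivalence = record
        { refl  = λ {X} → ≅-refl {X}
        ; sym   = λ {X} {Y} → ≅-sym {X} {Y}
        ; trans = λ {X} {Y} {Z} → ≅-trans {X} {Y} {Z}
        }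
      ; _≟_ = _≅?_
      }
    }

module Decision where

  open FiniteDifferences
  open Sums using ([_]; ΣVec; ΣVec-suc; ΣList-zero)
  open Counting
  open WixarikaDegree
  open ZetaSeries
  open Isomorphism
  open import Data.Empty using (⊥-elim)
  open import Data.Fin using (Fin)
  open import Data.Integer using (+_)
  open import Data.Integer.Properties using (+-injective)
  open import Data.List using ([]; _∷_; length; map; concatMap; filter; deduplicate; _++_)
  open import Data.List.Membership.Propositional using (_∈_; lose)
  open import Data.List.Membership.Propositional.Properties
    using (∈-map⁺; ∈-concat⁺′; ∈-++⁺ˡ; ∈-++⁺ʳ; ∈-filter⁺)
  import Data.List.Relation.Unary.All as All
  open import Data.List.Relation.Unary.All using (_∷_)
  import Data.List.Relation.Unary.All.Properties as All
  open import Data.List.Relation.Unary.Any using (here; there)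
  import Data.List.Relation.Unary.Any.Properties as Any
  open import Data.List.Relation.Unary.Unique.DecSetoid.Properties using (deduplicate-!)
  open import Data.Nat as ℕ using (zero; suc; _≤_; _<_; z<s; s≤s⁻¹)
  import Data.Nat.Properties as ℕₚ
  open import Data.Product using (_,_; proj₂)
  open import Data.Vec using (Vec)
  open import Relation.Nullary using (yes; no)
  open import Relation.Nullary.Decidable using (map′)
  open import Relation.Binary.PropositionalEquality hiding ([_])

  size-pos : ∀ t → 0 < size ⟦ t ⟧
  size-pos t with size-suc t
  ... | _ , eq = subst (0 <_) (sym eq) z<s

  terms : ℕ → List WTerm
  terms zero    = []
  terms (suc n) = one ∷ map d (terms n) ++ concatMap (λ s → map (s ·_) (terms n)) (terms n)

  ∈-terms : ∀ t {n} → size ⟦ t ⟧ ≤ n → t ∈ terms n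
  ∈-terms (s · t) {zero}  le = ⊥-elim (ℕₚ.n≮0 (ℕₚ.<-≤-trans (size-pos (s · t)) le))
  ∈-terms one     {suc n} _  = here refl
  ∈-terms (d t)   {suc n} le = there (∈-++⁺ˡ (∈-map⁺ d (∈-terms t t≤n)))
    where
    t≤n : size ⟦ t ⟧ ≤ n
    t≤n = ℕₚ.≤-trans (ℕₚ.n≤1+n _) (ℕₚ.≤-trans (ℕₚ.m≤m+n _ 1) (s≤s⁻¹ le))
  ∈-terms (s · t) {suc n} le = there (∈-++⁺ʳ (map d (terms n))
    (∈-concat⁺′ (∈-map⁺ (s ·_) (∈-terms t t≤n)) (∈-map⁺ (λ s → map (s ·_) (terms n)) (∈-terms s s≤n))))
    where
    s≤n : size ⟦ s ⟧ ≤ n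
    s≤n = s≤s⁻¹ (ℕₚ.<-≤-trans (ℕₚ.m<m+n _ (size-pos t)) le)
    t≤n : size ⟦ t ⟧ ≤ n
    t≤n = s≤s⁻¹ (ℕₚ.<-≤-trans (ℕₚ.m<n+m _ (size-pos s)) le)

  Ω°-zero : ∀ X → 0 < size X → Ω° X 0 ≡ 0
  Ω°-zero X 0<size = emptyChain (size X) 0<size (λ g → [ isStrict X g ])
    where
    emptyChain : ∀ k → 0 < k → (w : Vec (Fin 0) k → ℕ) → ΣVec k 0 w ≡ 0
    emptyChain (suc k) _ w = trans (ΣVec-suc k 0 w) (ΣList-zero (allVecs k 0))

  ζP≗Ω° : ∀ X → 0 < size X → ζP X ≗ Ω° X
  ζP≗Ω° X 0<size zero    = sym (Ω°-zero X 0<size)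
  ζP≗Ω° X 0<size (suc m) = refl

  ζP-≅ : ∀ {X Y} → X ≅ Y → ζP X ≗ ζP Y
  ζP-≅ X≅Y zero    = refl
  ζP-≅ {X} {Y} X≅Y (suc m) = Ω°-≅ {X} {Y} X≅Y (suc m)

  ζP≗series⇒Ωℤ≗ : ∀ t ds → ζP ⟦ t ⟧ ≗ seriesOf ds → Ωℤ ⟦ t ⟧ ≗ (λ m → + seriesOf ds m)
  ζP≗series⇒Ωℤ≗ t ds h m = cong +_ (trans (sym (ζP≗Ω° ⟦ t ⟧ (size-pos t) m)) (h m))

  _≗series?_ : ∀ t ds → Dec (ζP ⟦ t ⟧ ≗ seriesOf ds)
  t ≗series? ds = map′ fromℤ (ζP≗series⇒Ωℤ≗ t ds)
    (≗-dec bound (DegreeAtMost-mono (ℕₚ.m≤m+n (size ⟦ t ⟧) _) (degree≤ (proj₂ (Ωℤ-wixarika t))))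
                 (DegreeAtMost-mono (ℕₚ.m≤n+m _ (size ⟦ t ⟧)) (fromCoeffs-degree 1 ds)))
    where
    bound : ℕ
    bound = size ⟦ t ⟧ ℕ.+ suc (length ds)
    fromℤ : Ωℤ ⟦ t ⟧ ≗ (λ m → + seriesOf ds m) → ζP ⟦ t ⟧ ≗ seriesOf ds
    fromℤ h m = trans (ζP≗Ω° ⟦ t ⟧ (size-pos t) m) (+-injective (h m))

  -- A polynomial of degree |X| can only match a series of degree ≤ 1 + length ds.
  size-bound : ∀ ds t → ζP ⟦ t ⟧ ≗ seriesOf ds → size ⟦ t ⟧ ≤ suc (length ds)
  size-bound ds t h = degree-lower-bound (proj₂ (Ωℤ-wixarika t)) (λ ())
    (DegreeAtMost-cong (λ m → sym (ζP≗series⇒Ωℤ≗ t ds h m)) (fromCoeffs-degree 1 ds))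

  wixarikaWithSeries : List ℕ → List FinPoset
  wixarikaWithSeries ds = deduplicate _≅?_ (map ⟦_⟧ (filter (_≗series? ds) (terms (suc (length ds)))))

  HasSeries : List ℕ → FinPoset → Set
  HasSeries ds X = IsWixarika X × (ζP X ≗ seriesOf ds)

  wixarikaWithSeries-sound : ∀ ds → All (HasSeries ds) (wixarikaWithSeries ds)
  wixarikaWithSeries-sound ds = All.deduplicate⁺ _≅?_ (All.map⁺ (All.map (λ {t} h → (t , ≅-refl {⟦ t ⟧}) , h)
    (All.all-filter (_≗series? ds) (terms (suc (length ds))))))

  wixarikaWithSeries-complete : ∀ ds X → IsWixarika X → ζP X ≗ seriesOf ds → Any (X ≅_) (wixarikaWithSeries ds)
  wixarikaWithSeries-complete ds X (t , X≅t) h =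
    Any.deduplicate⁺ _≅?_ (λ {Y} {Z} Z≅Y X≅Y → ≅-trans {X} {Y} {Z} X≅Y (≅-sym {Z} {Y} Z≅Y))
      (Any.map⁺ (lose (∈-filter⁺ (_≗series? ds) (∈-terms t (size-bound ds t ht)) ht) X≅t))
    where
    ht : ζP ⟦ t ⟧ ≗ seriesOf ds
    ht m = trans (sym (ζP-≅ X≅t m)) (h m)

  wixarikaWithSeries-distinct : ∀ ds → AllPairs (λ X Y → ¬ (X ≅ Y)) (wixarikaWithSeries ds)
  wixarikaWithSeries-distinct ds = deduplicate-! ≅-decSetoid _

  ∃-dec-from-list : ∀ {A : Set} {P : A → Set} {R : A → A → Set} (xs : List A) →
                    All P xs → (∀ x → P x → Any (R x) xs) → Dec (∃ P)
  ∃-dec-from-list []       _        complete = no λ (x , px) → Any.¬Any[] (complete x px)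
  ∃-dec-from-list (x ∷ xs) (px ∷ _) _        = yes (x , px)

open Decision

theorem3p3 : Σ ((d : List ℕ) → Dec (∃ λ X → IsWixarika X × (ζP X ≗ seriesOf d))) λ decide →
               Σ (List ℕ → List FinPoset) λ alg →
                 (d : List ℕ) →
                   All (λ X → IsWixarika X × (ζP X ≗ seriesOf d)) (alg d)
                   × ((X : FinPoset) → IsWixarika X → ζP X ≗ seriesOf d → Any (X ≅_) (alg d))
                   × AllPairs (λ X Y → ¬ (X ≅ Y)) (alg d)
theorem3p3 =
    (λ ds → ∃-dec-from-list {R = _≅_} (wixarikaWithSeries ds) (wixarikaWithSeries-sound ds)
                            (λ X (wixarika , series) → wixarikaWithSeries-complete ds X wixarika series))
  , wixarikaWithSeries
  , λ ds → wixarikaWithSeries-sound ds , wixarikaWithSeries-complete ds , wixarikaWithSeries-distinct ds
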